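{- For every even integer $r \geq 2$ and every integer $w \geq 1$, there exists a graph $G$ such that $\mathrm{simw}(G) = 1$ while $\mathrm{simw}(G^r) \geq w$. In particular, for every fixed even integer $r \geq 2$, there is no function $f$ such that $\mathrm{simw}(G^r) \leq f(\mathrm{simw}(G))$ for all graphs $G$.
   Context: All graphs are finite and simple. $G^r$ has vertex set $V(G)$, distinct vertices adjacent iff at distance at most $r$ in $G$. A branch decomposition of $H$ is a pair $(T,\delta)$ with $T$ a tree of maximum degree at most $3$ and $\delta$ a bijection from $V(H)$ to the leaves of $T$; each edge $e$ of $T$ induces a bipartition $(A_e,\overline{A_e})$ of $V(H)$. For $X\subseteq V(H)$, $\mathrm{cutsim}_H(X)$ is the maximum size of a matching of $H$ whose edges each join $X$ to $V(H)\setminus X$ and which is an induced matching of $H$. $\mathrm{simw}(H)$ is the minimum over branch decompositions of $\max_e\mathrm{cutsim}_H(A_e)$, and $0$ if $|V(H)|\le 1$. -}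

module Defs where

open import Data.Nat using (ℕ; zero; suc; _≤_; _<_)
open import Data.Fin using (Fin; zero; suc; inject₁; fromℕ)
open import Data.Product using (Σ; ∃; _×_; _,_)
open import Data.Sum using (_⊎_)
open import Relation.Nullary using (¬_)
open import Relation.Binary.PropositionalEquality using (_≡_; _≢_)
open import Function.Definitions using (Injective)

record Graph (n : ℕ) : Set₁ where
  field
    Adj   : Fin n → Fin n → Set
    sym   : ∀ {u v} → Adj u v → Adj v u
    irrefl : ∀ v → ¬ Adj v v
open Graph public

data Walk {n : ℕ} (R : Fin n → Fin n → Set) : ℕ → Fin n → Fin n → Set where
  []  : ∀ {v} → Walk R 0 v v
  _∷_ : ∀ {k u w v} → R u w → Walk R k w v → Walk R (suc k) u v

DistAtMost : ∀ {n} → Graph n → ℕ → Fin n → Fin n → Set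
DistAtMost G r u v = Σ ℕ λ k → k ≤ r × Walk (Adj G) k u v

PowerAdj : ∀ {n} → Graph n → ℕ → Fin n → Fin n → Set
PowerAdj G r u v = u ≢ v × DistAtMost G r u v

power : ∀ {n} → Graph n → ℕ → Graph n
power G r = record
  { Adj = PowerAdj G r
  ; sym = λ { (u≢v , k , k≤r , w) → (λ e → u≢v (symEq e)) , k , k≤r , rev w }
  ; irrefl = λ { v (v≢v , _) → v≢v _≡_.refl }
  }
  where
  symEq : ∀ {A : Set} {a b : A} → a ≡ b → b ≡ a
  symEq _≡_.refl = _≡_.refl
  open import Data.Nat.Properties using (+-comm)
  snoc : ∀ {k u w v} → Walk (Adj G) k u w → Adj G w v → Walk (Adj G) (suc k) u v
  snoc [] e = e ∷ []
  snoc (x ∷ p) e = x ∷ snoc p e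
  rev : ∀ {k u v} → Walk (Adj G) k u v → Walk (Adj G) k v u
  rev [] = []
  rev (x ∷ p) = snoc (rev p) (Graph.sym G x)

Connected : ∀ {m} → Graph m → Set
Connected T = ∀ u v → Σ ℕ λ k → Walk (Adj T) k u v

-- A cycle of length j+3: distinct vertices f 0, …, f (j+2), consecutive ones
-- adjacent, and f (j+2) adjacent to f 0.
HasCycle : ∀ {m} → Graph m → Set
HasCycle {m} T =
  Σ ℕ λ j → Σ (Fin (suc (suc (suc j))) → Fin m) λ f →
    Injective _≡_ _≡_ f
    × (∀ (i : Fin (suc (suc j))) → Adj T (f (inject₁ i)) (f (suc i)))
    × Adj T (f (fromℕ (suc (suc j)))) (f zero)

IsTree : ∀ {m} → Graph m → Set
IsTree T = Connected T × ¬ HasCycle T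

DegAtMost : ∀ {m} → Graph m → ℕ → Fin m → Set
DegAtMost {m} T d t =
  ¬ (Σ (Fin (suc d) → Fin m) λ f → Injective _≡_ _≡_ f × (∀ i → Adj T t (f i)))

-- Leaves of a tree: vertices of degree at most 1
-- (degree exactly 1 whenever the tree has at least 2 vertices).
IsLeaf : ∀ {m} → Graph m → Fin m → Set
IsLeaf T t = DegAtMost T 1 t

record BranchDecomposition (n : ℕ) : Set₁ where
  field
    m       : ℕ
    T       : Graph m
    isTree  : IsTree T
    maxDeg3 : ∀ t → DegAtMost T 3 t
    δ       : Fin n → Fin m
    δ-inj   : Injective _≡_ _≡_ δ
    δ-leaf  : ∀ v → IsLeaf T (δ v)
    δ-onto  : ∀ t → IsLeaf T t → Σ (Fin n) λ v → δ v ≡ t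

  TMinus : Fin m → Fin m → Fin m → Fin m → Set
  TMinus a b x y = Adj T x y × ¬ (x ≡ a × y ≡ b) × ¬ (x ≡ b × y ≡ a)

  -- A_e for the edge e = ab : the vertices of H mapped into the component
  -- of T − e containing a.
  Side : Fin m → Fin m → Fin n → Set
  Side a b v = Σ ℕ λ k → Walk (TMinus a b) k a (δ v)
open BranchDecomposition public

InducedCrossMatching : ∀ {n} → Graph n → (Fin n → Set) → ℕ → Set
InducedCrossMatching {n} H X s =
  Σ (Fin s → Fin n) λ x → Σ (Fin s → Fin n) λ y →
    (∀ i → X (x i)) × (∀ i → ¬ X (y i)) × (∀ i → Adj H (x i) (y i))
    × Injective _≡_ _≡_ x × Injective _≡_ _≡_ y
    × (∀ i j → i ≢ j →
         ¬ Adj H (x i) (x j) × ¬ Adj H (x i) (y j)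
         × ¬ Adj H (y i) (x j) × ¬ Adj H (y i) (y j))

CutsimAtMost : ∀ {n} → Graph n → (Fin n → Set) → ℕ → Set
CutsimAtMost H X k = ∀ s → InducedCrossMatching H X s → s ≤ k

SimwAtMost : ∀ {n} → Graph n → ℕ → Set₁
SimwAtMost {n} H k =
  (n ≤ 1) ⊎
  Σ (BranchDecomposition n) λ D →
    ∀ a b → Adj (T D) a b → CutsimAtMost H (Side D a b) k

SimwIs : ∀ {n} → Graph n → ℕ → Set₁
SimwIs H k = SimwAtMost H k × (∀ j → j < k → ¬ SimwAtMost H j)

SimwAtLeast : ∀ {n} → Graph n → ℕ → Set₁
SimwAtLeast H w = ∀ j → j < w → ¬ SimwAtMost H j

Even : ℕ → Set
Even r = Σ ℕ λ h → r ≡ h Data.Nat.+ h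
  where import Data.Nat

-- Let S be the split graph with a clique K and independent vertices A i (i < N) and S i j, where
-- S i j has one clique neighbour in common with A i and another with A j; hang a path of h edges
-- from every vertex of S to obtain G, and put r = 2h + 2.
-- The caterpillar decomposition of G, following the pendant paths, has every cut crossed only
-- through a clique of G (the bottom copy of K, or a single vertex), so simw(G) = 1.
-- In G^r the tops of A i and S i j are adjacent, while the tops of two independent vertices of S
-- sharing no index are more than r apart, by a 1-Lipschitz potential on G.
-- A branch decomposition of G^r has maximum degree 3, so for N = 3w - 1 one of its edges has w tops
-- of A-vertices on each side; pairing each A i inside with an A j outside through S i j yields an
-- induced matching of size w across that cut.

module Submission where

open import Level using (0ℓ)
open import Data.Nat using (ℕ; zero; suc; _+_; _*_; _∸_; _≤_; _<_; z≤n; s≤s; _≤?_)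
import Data.Nat.Properties as ℕ
open import Data.Nat.Properties
  using ( ≤-refl; ≤-trans; ≤-reflexive; <-trans; <-irrefl; ≤-pred; ≰⇒>; ≰⇒≥; <⇒≱; n≤1+n; m≤m+n; m≤n+m
        ; +-mono-≤; +-monoʳ-≤; +-monoˡ-≤; +-monoʳ-<; *-monoˡ-≤; +-identityʳ; +-suc
        ; ∸-monoʳ-≤; 0∸n≡0; n∸n≡0; +-*-semiring; module ≤-Reasoning )
open import Data.Nat.Tactic.RingSolver using (solve-∀)
open import Algebra.Properties.Semiring.Sum +-*-semiring using (sum; ∑-distrib-+; *-distribʳ-sum)
open import Data.Fin using (Fin; zero; suc; toℕ; inject₁; fromℕ; fromℕ<; lower₁)
open import Data.Fin.Patterns using (0F; 1F)
open import Data.Fin.Properties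
  using ( _≟_; ¬Fin0; 0≢1+n; suc-injective; toℕ-injective; toℕ<n; toℕ-fromℕ; toℕ-fromℕ<; fromℕ-def; toℕ-inject₁
        ; toℕ-lower₁; inject₁-lower₁; any?; injective⇒≤; pigeonhole; +↔⊎; *↔×; 2↔Bool )
open import Data.Vec using (Vec; []; _∷_; lookup)
open import Data.Bool using (Bool; true; false)
open import Data.Unit using (⊤; tt)
open import Data.Empty using (⊥; ⊥-elim)
open import Data.Product using (Σ; ∃; _×_; _,_; proj₁; proj₂)
open import Data.Product.Function.NonDependent.Propositional using (_×-↔_)
import Data.Sum
open import Data.Sum using (_⊎_; inj₁; inj₂; [_,_]′)
open import Data.Sum.Properties using (inj₁-injective; inj₂-injective)
open import Data.Sum.Function.Propositional using (_⊎-↔_)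
open import Relation.Nullary using (¬_; Dec; yes; no)
open import Relation.Nullary.Decidable using (_×-dec_; _⊎-dec_; ¬?; ¬¬-excluded-middle; map′)
open import Relation.Unary using (Pred; Decidable)
open import Relation.Binary.PropositionalEquality using (_≡_; _≢_; refl; sym; trans; cong; subst; subst₂)
open import Function.Base using (_∘_)
open import Function.Definitions using (Injective)
open import Function.Bundles using (Inverse; _↔_)
open import Function.Properties.Inverse using (↔-refl)
open import Function.Construct.Symmetry using (↔-sym)
open import Function.Construct.Composition using (_↔-∘_)

open import Defs renaming (sym to Adj-sym)

module _ {n : ℕ} where

  mapWalk : {R S : Fin n → Fin n → Set} → (∀ {x y} → R x y → S x y) →
            ∀ {k u v} → Walk R k u v → Walk S k u v
  mapWalk f []      = []
  mapWalk f (e ∷ p) = f e ∷ mapWalk f p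

  injective-tail : ∀ {k x} {vs : Vec (Fin n) k} →
                   Injective _≡_ _≡_ (lookup (x ∷ vs)) → Injective _≡_ _≡_ (lookup vs)
  injective-tail inj eq = suc-injective (inj eq)

  injective-cons : ∀ {k x} {vs : Vec (Fin n) k} →
                   Injective _≡_ _≡_ (lookup vs) → ¬ (∃ λ i → x ≡ lookup vs i) →
                   Injective _≡_ _≡_ (lookup (x ∷ vs))
  injective-cons inj x∉ {zero}  {zero}  eq = refl
  injective-cons inj x∉ {zero}  {suc j} eq = ⊥-elim (x∉ (j , eq))
  injective-cons inj x∉ {suc i} {zero}  eq = ⊥-elim (x∉ (i , sym eq))
  injective-cons inj x∉ {suc i} {suc j} eq = cong suc (inj eq)

  module _ {R : Fin n → Fin n → Set} where

    vertices : ∀ {k u v} → Walk R k u v → Vec (Fin n) (suc k)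
    vertices {u = u} []      = u ∷ []
    vertices {u = u} (_ ∷ p) = u ∷ vertices p

    IsPath : ∀ {k u v} → Walk R k u v → Set
    IsPath p = Injective _≡_ _≡_ (lookup (vertices p))

    Path : Fin n → Fin n → Set
    Path u v = Σ ℕ λ k → Σ (Walk R k u v) IsPath

    _∷ʳ_ : ∀ {k u v x} → Walk R k u v → R v x → Walk R (suc k) u x
    []      ∷ʳ e′ = e′ ∷ []
    (e ∷ p) ∷ʳ e′ = e ∷ (p ∷ʳ e′)

    reverseWalk : (∀ {x y} → R x y → R y x) → ∀ {k u v} → Walk R k u v → Walk R k v u
    reverseWalk R-sym []      = []
    reverseWalk R-sym (e ∷ p) = reverseWalk R-sym p ∷ʳ R-sym e

    _++_ : ∀ {k l u v x} → Walk R k u v → Walk R l v x → Walk R (k + l) u x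
    []      ++ q = q
    (e ∷ p) ++ q = e ∷ (p ++ q)

    vertices-head : ∀ {k u v} (p : Walk R k u v) → lookup (vertices p) zero ≡ u
    vertices-head []      = refl
    vertices-head (_ ∷ _) = refl

    vertices-last : ∀ {k u v} (p : Walk R k u v) → lookup (vertices p) (fromℕ k) ≡ v
    vertices-last []      = refl
    vertices-last (_ ∷ p) = vertices-last p

    vertices-step : ∀ {k u v} (p : Walk R k u v) (i : Fin k) →
                    R (lookup (vertices p) (inject₁ i)) (lookup (vertices p) (suc i))
    vertices-step {u = u} (e ∷ p) zero = subst (R u) (sym (vertices-head p)) e
    vertices-step (_ ∷ p) (suc i)      = vertices-step p i

    IsPath-[] : ∀ {u} → IsPath {u = u} []
    IsPath-[] {_} {zero} {zero} _ = refl

    path-length< : ∀ {k u v} (p : Walk R k u v) → IsPath p → k < n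
    path-length< p = injective⇒≤

    suffix : ∀ {k u v} (p : Walk R k u v) (i : Fin (suc k)) → IsPath p →
             Path (lookup (vertices p) i) v
    suffix []      zero    isPath = _ , [] , isPath
    suffix (e ∷ p) zero    isPath = _ , e ∷ p , isPath
    suffix (e ∷ p) (suc i) isPath = suffix p i (injective-tail isPath)

    walk⇒path : ∀ {k u v} → Walk R k u v → Path u v
    walk⇒path []                   = 0 , [] , IsPath-[]
    walk⇒path {u = u} (e ∷ p) with walk⇒path p
    ... | k , q , isPath with any? (λ i → u ≟ lookup (vertices q) i)
    ...   | yes (i , u≡qᵢ) = subst (λ x → Path x _) (sym u≡qᵢ) (suffix q i isPath)
    ...   | no  u∉q        = suc k , e ∷ q , injective-cons isPath u∉q

    Occurs : ∀ {k l} → Vec (Fin n) k → Vec (Fin n) l → Set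
    Occurs xs ys = ∀ j → ∃ λ j′ → lookup xs j ≡ lookup ys j′

    prefix : ∀ {k u v} (p : Walk R k u v) (i : Fin (suc k)) → IsPath p →
             Σ (Walk R (toℕ i) u (lookup (vertices p) i)) λ q →
               IsPath q × Occurs (vertices q) (vertices p)
    prefix []      zero    _      = [] , IsPath-[] , λ { zero → zero , refl }
    prefix (e ∷ p) zero    _      = [] , IsPath-[] , λ { zero → zero , refl }
    prefix {u = u} (e ∷ p) (suc i) isPath with prefix p i (injective-tail isPath)
    ... | q , q-path , q⊆p = e ∷ q , injective-cons q-path u∉q , occurs
      where
      u∉q : ¬ (∃ λ j → u ≡ lookup (vertices q) j)
      u∉q (j , u≡qⱼ) with q⊆p j
      ... | j′ , qⱼ≡pⱼ′ with isPath {zero} {suc j′} (trans u≡qⱼ qⱼ≡pⱼ′)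
      ... | ()
      occurs : Occurs (vertices (e ∷ q)) (vertices (e ∷ p))
      occurs zero    = zero , refl
      occurs (suc j) = let j′ , eq = q⊆p j in suc j′ , eq

    Avoiding : Fin n → Fin n → Fin n → Set
    Avoiding t x y = R x y × x ≢ t × y ≢ t

    lastVisit : ∀ {k u v} (t : Fin n) → Walk R k u v → v ≢ t →
                (u ≢ t × ∃ λ k′ → Walk (Avoiding t) k′ u v) ⊎
                (∃ λ t′ → R t t′ × ∃ λ k′ → Walk (Avoiding t) k′ t′ v)
    lastVisit t []      v≢t = inj₁ (v≢t , 0 , [])
    lastVisit {u = u} t (e ∷ p) v≢t with lastVisit t p v≢t
    ... | inj₂ after = inj₂ after
    ... | inj₁ (x≢t , k′ , q) with u ≟ t
    ...   | yes refl = inj₂ (_ , e , k′ , q)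
    ...   | no  u≢t  = inj₁ (u≢t , suc k′ , (e , u≢t , x≢t) ∷ q)

  vertices-mapWalk : {R S : Fin n → Fin n → Set} (f : ∀ {x y} → R x y → S x y) →
                     ∀ {k u v} (p : Walk R k u v) → vertices (mapWalk f p) ≡ vertices p
  vertices-mapWalk f []      = refl
  vertices-mapWalk f (_ ∷ p) = cong (_ ∷_) (vertices-mapWalk f p)

  mapWalk-IsPath : {R S : Fin n → Fin n → Set} (f : ∀ {x y} → R x y → S x y) →
                   ∀ {k u v} (p : Walk R k u v) → IsPath p → IsPath (mapWalk f p)
  mapWalk-IsPath f p isPath eq rewrite vertices-mapWalk f p = isPath eq

path+edge⇒cycle : ∀ {m} (T : Graph m) {j u v} (p : Walk (Adj T) (suc (suc j)) u v) →
                  IsPath p → Adj T v u → HasCycle T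
path+edge⇒cycle T {j} p isPath e =
  j , lookup (vertices p) , isPath , vertices-step p ,
  subst₂ (Adj T) (sym (vertices-last p)) (sym (vertices-head p)) e

[_] : ∀ {A : Set} → Dec A → ℕ
[ yes _ ] = 1
[ no  _ ] = 0

count : ∀ {k} {P : Pred (Fin k) 0ℓ} → Decidable P → ℕ
count P? = sum λ i → [ P? i ]

sum-mono : ∀ {l} (f g : Fin l → ℕ) → (∀ u → f u ≤ g u) → sum f ≤ sum g
sum-mono {zero}  f g f≤g = z≤n
sum-mono {suc l} f g f≤g = +-mono-≤ (f≤g zero) (sum-mono (f ∘ suc) (g ∘ suc) (f≤g ∘ suc))

module _ {k : ℕ} {P Q : Pred (Fin k) 0ℓ} (P? : Decidable P) (Q? : Decidable Q) where

  count-mono : (∀ i → P i → Q i) → count P? ≤ count Q?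
  count-mono P⊆Q = sum-mono _ _ λ i → []-mono (P? i) (Q? i) (P⊆Q i)
    where
    []-mono : ∀ {A B : Set} (a? : Dec A) (b? : Dec B) → (A → B) → [ a? ] ≤ [ b? ]
    []-mono (no  _) _        _   = z≤n
    []-mono (yes _) (yes _)  _   = ≤-refl
    []-mono (yes a) (no ¬b)  a→b = ⊥-elim (¬b (a→b a))

  count-cover : {R : Pred (Fin k) 0ℓ} (R? : Decidable R) → (∀ i → R i → P i ⊎ Q i) →
                count R? ≤ count P? + count Q?
  count-cover R? R⊆P∪Q =
    ≤-trans (sum-mono _ _ λ i → []-cover (R? i) (P? i) (Q? i) (R⊆P∪Q i))
            (≤-reflexive (∑-distrib-+ (λ i → [ P? i ]) (λ i → [ Q? i ])))
    where
    []-cover : ∀ {A B C : Set} (a? : Dec A) (b? : Dec B) (c? : Dec C) → (A → B ⊎ C) →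
               [ a? ] ≤ [ b? ] + [ c? ]
    []-cover (no  _) _       _       _ = z≤n
    []-cover (yes _) (yes _) _       _ = s≤s z≤n
    []-cover (yes _) (no _)  (yes _) _ = s≤s z≤n
    []-cover (yes a) (no ¬b) (no ¬c) h with h a
    ... | inj₁ b = ⊥-elim (¬b b)
    ... | inj₂ c = ⊥-elim (¬c c)

count-all : ∀ {k} {P : Pred (Fin k) 0ℓ} (P? : Decidable P) → (∀ i → P i) → count P? ≡ k
count-all {zero}  P? all = refl
count-all {suc k} P? all with P? zero
... | yes _  = cong suc (count-all (P? ∘ suc) (all ∘ suc))
... | no ¬p₀ = ⊥-elim (¬p₀ (all zero))

count-none : ∀ {k} {P : Pred (Fin k) 0ℓ} (P? : Decidable P) → (∀ i → ¬ P i) → count P? ≡ 0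
count-none {zero}  P? none = refl
count-none {suc k} P? none with P? zero
... | yes p₀ = ⊥-elim (none zero p₀)
... | no _   = count-none (P? ∘ suc) (none ∘ suc)

count-unique : ∀ {k} {P : Pred (Fin k) 0ℓ} (P? : Decidable P) →
               (∀ i j → P i → P j → i ≡ j) → count P? ≤ 1
count-unique {zero}  P? unique = z≤n
count-unique {suc k} P? unique with P? zero
... | yes p₀ = ≤-reflexive (cong suc (count-none (P? ∘ suc) λ i pᵢ → 0≢1+n (unique zero (suc i) p₀ pᵢ)))
... | no _   = count-unique (P? ∘ suc) λ i j pᵢ pⱼ → suc-injective (unique (suc i) (suc j) pᵢ pⱼ)

count-∃ : ∀ {k l} {R : Pred (Fin k) 0ℓ} {Q : Fin l → Pred (Fin k) 0ℓ} →
          (R? : Decidable R) (Q? : ∀ u → Decidable (Q u)) →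
          (∀ i → R i → ∃ λ u → Q u i) → count R? ≤ sum λ u → count (Q? u)
count-∃ {l = zero}  R? Q? R⊆∃Q = ≤-reflexive (count-none R? λ i rᵢ → ¬Fin0 (proj₁ (R⊆∃Q i rᵢ)))
count-∃ {l = suc l} {Q = Q} R? Q? R⊆∃Q =
  ≤-trans (count-cover (Q? zero) Q⁺? R? split)
          (+-monoʳ-≤ (count (Q? zero)) (count-∃ Q⁺? (Q? ∘ suc) λ i r → r))
  where
  Q⁺? : Decidable λ i → ∃ λ u → Q (suc u) i
  Q⁺? i = any? λ u → Q? (suc u) i
  split : ∀ i → _ → Q zero i ⊎ ∃ λ u → Q (suc u) i
  split i rᵢ with R⊆∃Q i rᵢ
  ... | zero  , q = inj₁ q
  ... | suc u , q = inj₂ (u , q)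

count⇒injection : ∀ {k} {P : Pred (Fin k) 0ℓ} (P? : Decidable P) {w} → w ≤ count P? →
                  Σ (Fin w → Fin k) λ f → Injective _≡_ _≡_ f × (∀ t → P (f t))
count⇒injection P? {zero} _ = (λ ()) , (λ { {()} }) , λ ()
count⇒injection {suc k} {P} P? {suc w} w<count with P? zero
... | yes p₀ = let f , f-inj , Pf = count⇒injection (P? ∘ suc) (≤-pred w<count) in
               extend f , extend-injective f-inj , extend-P p₀ Pf
  where
  extend : (Fin w → Fin k) → Fin (suc w) → Fin (suc k)
  extend f zero    = zero
  extend f (suc t) = suc (f t)
  extend-injective : ∀ {f} → Injective _≡_ _≡_ f → Injective _≡_ _≡_ (extend f)
  extend-injective inj {zero}  {zero}  _  = refl
  extend-injective inj {suc _} {suc _} eq = cong suc (inj (suc-injective eq))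
  extend-P : ∀ {f} → P zero → (∀ t → P (suc (f t))) → ∀ t → P (extend f t)
  extend-P p₀ Pf zero    = p₀
  extend-P p₀ Pf (suc t) = Pf t
... | no _   = let f , f-inj , Pf = count⇒injection (P? ∘ suc) w<count in
               suc ∘ f , f-inj ∘ suc-injective , Pf

-- The two sides of an edge of a branch decomposition

leaf-unique-neighbour : ∀ {m} (T : Graph m) {x s t} → IsLeaf T x → Adj T x s → Adj T x t → s ≡ t
leaf-unique-neighbour T {x} {s} {t} leaf xs xt with s ≟ t
... | yes s≡t = s≡t
... | no  s≢t = ⊥-elim (leaf (pair , pair-injective , λ { zero → xs ; (suc zero) → xt }))
  where
  pair : Fin 2 → Fin _
  pair zero    = s
  pair (suc _) = t
  pair-injective : Injective _≡_ _≡_ pair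
  pair-injective {zero}     {zero}     _  = refl
  pair-injective {zero}     {suc zero} eq = ⊥-elim (s≢t eq)
  pair-injective {suc zero} {zero}     eq = ⊥-elim (s≢t (sym eq))
  pair-injective {suc zero} {suc zero} _  = refl

module Sides {n : ℕ} (D : BranchDecomposition n) where

  private
    Tr : Graph (m D)
    Tr = T D

  edge-≢ : ∀ {a b} → Adj Tr a b → a ≢ b
  edge-≢ {a} e refl = irrefl Tr a e

  Avoiding⇒TMinus : ∀ {a b x y} → Avoiding {R = Adj Tr} a x y → TMinus D a b x y × TMinus D b a x y
  Avoiding⇒TMinus (e , x≢a , y≢a) =
    (e , x≢a ∘ proj₁ , y≢a ∘ proj₂) , (e , y≢a ∘ proj₂ , x≢a ∘ proj₁)

  leaveVertex : ∀ u v → δ D v ≡ u ⊎ ∃ λ u′ → Adj Tr u u′ × ∃ λ k → Walk (Avoiding u) k u′ (δ D v)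
  leaveVertex u v with δ D v ≟ u
  ... | yes δv≡u = inj₁ δv≡u
  ... | no  δv≢u with lastVisit u (proj₂ (proj₁ (isTree D) u (δ D v))) δv≢u
  ...   | inj₁ (u≢u , _)     = ⊥-elim (u≢u refl)
  ...   | inj₂ (u′ , e , away) = inj₂ (u′ , e , away)

  Side-around : ∀ u v → δ D v ≡ u ⊎ ∃ λ u′ → Adj Tr u u′ × Side D u′ u v
  Side-around u v with leaveVertex u v
  ... | inj₁ δv≡u                  = inj₁ δv≡u
  ... | inj₂ (u′ , e , k , away) = inj₂ (u′ , e , k , mapWalk (proj₂ ∘ Avoiding⇒TMinus) away)

  Side-total : ∀ {a b} → Adj Tr a b → ∀ v → Side D a b v ⊎ Side D b a v
  Side-total {a} {b} ab v with leaveVertex a v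
  ... | inj₁ δv≡a = inj₁ (0 , subst (Walk _ 0 a) (sym δv≡a) [])
  ... | inj₂ (u′ , e , k , away) with u′ ≟ b
  ...   | yes refl = inj₂ (k , mapWalk (proj₂ ∘ Avoiding⇒TMinus) away)
  ...   | no  u′≢b =
    inj₁ (suc k , (e , u′≢b ∘ proj₂ , edge-≢ ab ∘ proj₁) ∷ mapWalk (proj₁ ∘ Avoiding⇒TMinus) away)

  Side-disjoint : ∀ {a b} → Adj Tr a b → ∀ v → Side D a b v → ¬ Side D b a v
  Side-disjoint {a} {b} ab v (_ , from-a) (_ , from-b)
    with walk⇒path (from-a ++ reverseWalk TMinus-sym (mapWalk TMinus-swap from-b))
    where
    TMinus-sym : ∀ {x y} → TMinus D a b x y → TMinus D a b y x
    TMinus-sym (e , n₁ , n₂) = Adj-sym Tr e , (λ (p , q) → n₂ (q , p)) , (λ (p , q) → n₁ (q , p))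
    TMinus-swap : ∀ {x y} → TMinus D b a x y → TMinus D a b x y
    TMinus-swap (e , n₁ , n₂) = e , n₂ , n₁
  ... | _ , []          , _      = edge-≢ ab refl
  ... | _ , e ∷ []      , _      = proj₁ (proj₂ e) (refl , refl)
  ... | _ , e ∷ e′ ∷ p , isPath =
    proj₂ (isTree D) (path+edge⇒cycle Tr (mapWalk proj₁ (e ∷ e′ ∷ p))
                        (mapWalk-IsPath proj₁ (e ∷ e′ ∷ p) isPath) (Adj-sym Tr ab))

  Side-closed : ∀ {a b} (Z : Pred (Fin (m D)) 0ℓ) → Z a → (∀ {x y} → Z x → TMinus D a b x y → Z y) →
                ∀ v → Side D a b v → Z (δ D v)
  Side-closed {a} {b} Z Za step v (_ , p) = along p Za
    where
    along : ∀ {k x y} → Walk (TMinus D a b) k x y → Z x → Z y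
    along []      z = z
    along (e ∷ p) z = along p (step z e)

  leafEdge-separates : ∀ u v → u ≢ v → ∃ λ a → ∃ λ b → Adj Tr a b × Side D a b u × ¬ Side D a b v
  leafEdge-separates u v u≢v with firstEdge (proj₂ (proj₁ (isTree D) (δ D u) (δ D v))) (u≢v ∘ δ-inj D)
    where
    firstEdge : ∀ {k x y} → Walk (Adj Tr) k x y → x ≢ y → ∃ λ t → Adj Tr x t
    firstEdge []      x≢x = ⊥-elim (x≢x refl)
    firstEdge (e ∷ _) _   = _ , e
  ... | t , e = δ D u , t , e , (0 , []) , λ (_ , p) → u≢v (δ-inj D (sym (stuck p)))
    where
    stuck : ∀ {k y} → Walk (TMinus D (δ D u) t) k (δ D u) y → y ≡ δ D u
    stuck []                      = refl
    stuck ((e′ , not-e , _) ∷ _) = ⊥-elim (not-e (refl , leaf-unique-neighbour Tr (δ-leaf D u) e′ e))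

Fin≤1-unique : ∀ {n} → n ≤ 1 → (u v : Fin n) → u ≡ v
Fin≤1-unique {suc zero}    _            zero zero = refl
Fin≤1-unique {suc (suc _)} (s≤s ())     _    _

simw≥1 : ∀ {n} (H : Graph n) {u v} → Adj H u v → ¬ SimwAtMost H 0
simw≥1 H {u} {v} uv (inj₁ n≤1) = irrefl H v (subst (λ x → Adj H x v) (Fin≤1-unique n≤1 u v) uv)
simw≥1 H {u} {v} uv (inj₂ (D , cuts))
  with Sides.leafEdge-separates D u v (λ { refl → irrefl H u uv })
... | a , b , ab , u∈A , v∉A with cuts a b ab 1 single-edge
  where
  single-edge : InducedCrossMatching H (Side D a b) 1
  single-edge = (λ _ → u) , (λ _ → v) , (λ _ → u∈A) , (λ _ → v∉A) , (λ _ → uv) ,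
                (λ { {zero} {zero} _ → refl }) , (λ { {zero} {zero} _ → refl }) ,
                λ { zero zero 0≢0 → ⊥-elim (0≢0 refl) }
... | ()

-- Of two edges of an induced matching across X, one endpoint each lies in Q; being distinct,
-- those endpoints would be adjacent.
cutsim≤1-of-cliqueCover : ∀ {n} (H : Graph n) (X Q : Pred (Fin n) 0ℓ) →
                          (∀ u v → Q u → Q v → u ≢ v → Adj H u v) →
                          (∀ u v → Adj H u v → X u → ¬ X v → Q u ⊎ Q v) →
                          CutsimAtMost H X 1
cutsim≤1-of-cliqueCover H X Q clique cover zero          _ = z≤n
cutsim≤1-of-cliqueCover H X Q clique cover (suc zero)    _ = ≤-refl
cutsim≤1-of-cliqueCover H X Q clique cover (suc (suc s)) (x , y , x∈X , y∉X , xy , x-inj , y-inj , induced)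
  with cover _ _ (xy zero) (x∈X zero) (y∉X zero) | cover _ _ (xy 1F) (x∈X 1F) (y∉X 1F)
     | induced zero 1F (λ ())
... | inj₁ q₀ | inj₁ q₁ | ¬xx , _ , _ , _ = ⊥-elim (¬xx (clique _ _ q₀ q₁ (0≢1+n ∘ x-inj)))
... | inj₁ q₀ | inj₂ q₁ | _ , ¬xy , _ , _ =
  ⊥-elim (¬xy (clique _ _ q₀ q₁ (λ eq → y∉X 1F (subst X eq (x∈X zero)))))
... | inj₂ q₀ | inj₁ q₁ | _ , _ , ¬yx , _ =
  ⊥-elim (¬yx (clique _ _ q₀ q₁ (λ eq → y∉X zero (subst X (sym eq) (x∈X 1F)))))
... | inj₂ q₀ | inj₂ q₁ | _ , _ , _ , ¬yy = ⊥-elim (¬yy (clique _ _ q₀ q₁ (0≢1+n ∘ y-inj)))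

-- A lower bound on simw from induced matchings across every balanced cut

InducedMatchingsAcross : ∀ {n} (H : Graph n) {N} (a : Fin N → Fin n) (w : ℕ) → Set₁
InducedMatchingsAcross {n} H {N} a w =
  ∀ (X : Pred (Fin n) 0ℓ) → Decidable X → (e₁ e₂ : Fin w → Fin N) →
  Injective _≡_ _≡_ e₁ → Injective _≡_ _≡_ e₂ → (∀ t → X (a (e₁ t))) → (∀ t → ¬ X (a (e₂ t))) →
  InducedCrossMatching H X w

DegAtMost⇒count≤ : ∀ {m} (T : Graph m) {d u} → DegAtMost T d u → (Adj? : Decidable (Adj T u)) →
                   count Adj? ≤ d
DegAtMost⇒count≤ T {d} deg Adj? with count Adj? ≤? d
... | yes ≤d = ≤d
... | no  ≰d = ⊥-elim (deg (count⇒injection Adj? (≰⇒> ≰d)))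

module BalancedEdge {n N w′ : ℕ} (H : Graph n) (a : Fin N → Fin n) (a-inj : Injective _≡_ _≡_ a)
                    (N-large : 2 + 3 * w′ ≤ N) (matchings : InducedMatchingsAcross H a (suc w′))
                    (D : BranchDecomposition n) {j : ℕ} (j≤w′ : j ≤ w′)
                    (narrow : ∀ x y → Adj (T D) x y → CutsimAtMost H (Side D x y) j)
                    (Adj? : ∀ x → Decidable (Adj (T D) x)) (Side? : ∀ x y → Decidable (Side D x y)) where

  open Sides D

  private
    Tr : Graph (m D)
    Tr = T D

  Side-a? : ∀ x y → Decidable λ i → Side D x y (a i)
  Side-a? x y i = Side? x y (a i)

  Big : Fin (m D) → Fin (m D) → Set
  Big x y = suc w′ ≤ count (Side-a? x y)

  Big? : ∀ x y → Dec (Big x y)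
  Big? x y = suc w′ ≤? count (Side-a? x y)

  not-both-sides-big : ∀ {x y} → Adj Tr x y → Big x y → suc w′ ≤ count (¬? ∘ Side-a? x y) → ⊥
  not-both-sides-big {x} {y} xy big big-outside
    with count⇒injection (Side-a? x y) big | count⇒injection (¬? ∘ Side-a? x y) big-outside
  ... | e₁ , e₁-inj , inside | e₂ , e₂-inj , outside =
    <⇒≱ (s≤s j≤w′)
        (narrow x y xy (suc w′) (matchings (Side D x y) (Side? x y) e₁ e₂ e₁-inj e₂-inj inside outside))

  Big-antisym : ∀ {x y} → Adj Tr x y → Big x y → ¬ Big y x
  Big-antisym {x} {y} xy big big′ =
    not-both-sides-big xy big (≤-trans big′ (count-mono (Side-a? y x) (¬? ∘ Side-a? x y)
      λ i y-side x-side → Side-disjoint xy (a i) x-side y-side))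

  -- Around any tree vertex the a-vertices split into at most one at the vertex itself and
  -- the at most three branches, so some branch holds more than w′ of them.
  big-branch : ∀ u → ¬ (∀ u′ → Adj Tr u u′ → ¬ Big u′ u)
  big-branch u all-small = <⇒≱ N-large (begin
    N                                    ≡⟨ count-all any-i? (λ _ → tt) ⟨
    count any-i?                         ≤⟨ count-cover at-u? in-branch? any-i? (λ i _ → around i) ⟩
    count at-u? + count in-branch?       ≤⟨ +-mono-≤ (count-unique at-u? a-unique)
                                                     (count-∃ in-branch? branch? λ _ in-b → in-b) ⟩
    1 + sum (λ u′ → count (branch? u′))  ≤⟨ +-monoʳ-≤ 1 (sum-mono _ _ branch-small) ⟩
    1 + sum (λ u′ → [ Adj? u u′ ] * w′)  ≡⟨ cong (1 +_) (*-distribʳ-sum w′ (λ u′ → [ Adj? u u′ ])) ⟨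
    1 + count (Adj? u) * w′              ≤⟨ +-monoʳ-≤ 1 (*-monoˡ-≤ w′ (DegAtMost⇒count≤ Tr (maxDeg3 D u) (Adj? u))) ⟩
    1 + 3 * w′                           ∎)
    where
    open ≤-Reasoning
    any-i? : Decidable λ (_ : Fin N) → ⊤
    any-i? _ = yes tt
    at-u? : Decidable λ i → δ D (a i) ≡ u
    at-u? i = δ D (a i) ≟ u
    branch? : ∀ u′ → Decidable λ i → Adj Tr u u′ × Side D u′ u (a i)
    branch? u′ i = Adj? u u′ ×-dec Side? u′ u (a i)
    in-branch? : Decidable λ i → ∃ λ u′ → Adj Tr u u′ × Side D u′ u (a i)
    in-branch? i = any? λ u′ → branch? u′ i
    around : ∀ i → δ D (a i) ≡ u ⊎ ∃ λ u′ → Adj Tr u u′ × Side D u′ u (a i)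
    around i = Side-around u (a i)
    a-unique : ∀ i i′ → δ D (a i) ≡ u → δ D (a i′) ≡ u → i ≡ i′
    a-unique i i′ eq eq′ = a-inj (δ-inj D (trans eq (sym eq′)))
    branch-small : ∀ u′ → count (branch? u′) ≤ [ Adj? u u′ ] * w′
    branch-small u′ with Adj? u u′
    ... | yes uu′ = ≤-trans (count-mono (λ i → yes uu′ ×-dec Side? u′ u (a i)) (Side-a? u′ u) λ _ → proj₂)
                            (≤-trans (≤-pred (≰⇒> (all-small u′ uu′))) (≤-reflexive (sym (+-identityʳ w′))))
    ... | no ¬uu′ = ≤-reflexive (count-none (λ i → no ¬uu′ ×-dec Side? u′ u (a i)) λ _ → ¬uu′ ∘ proj₁)

  BigPath : ℕ → Set
  BigPath L = ∃ λ u → ∃ λ t → ∃ λ t₀ → Σ (Adj Tr u t) λ e → Σ (Walk (Adj Tr) L t t₀) λ p →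
              IsPath (e ∷ p) × Big u t

  bigPath-start : BigPath 0
  bigPath-start with any? (λ u → Adj? t₀ u ×-dec Big? u t₀)
    where
    t₀ : Fin (m D)
    t₀ = δ D (a (fromℕ< (≤-trans (s≤s z≤n) N-large)))
  ... | yes (u , e , big) = u , _ , _ , Adj-sym Tr e , [] , injective-cons (IsPath-[] {R = Adj Tr}) u∉ , big
    where
    u∉ : ¬ (∃ λ i → u ≡ lookup (_ ∷ []) i)
    u∉ (zero , refl) = edge-≢ e refl
  ... | no none = ⊥-elim (big-branch _ λ u e big → none (u , e , big))

  -- Extend a big path at its start: the big side at u has a big branch, which is not the one
  -- through t (Big-antisym), and whose root is off the path (acyclicity).
  bigPath-extend : ∀ {L} → BigPath L → BigPath (suc L)
  bigPath-extend (u , t , t₀ , e , p , isPath , big)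
    with any? (λ u′ → Adj? u u′ ×-dec (¬? (u′ ≟ t) ×-dec Big? u′ u))
  ... | yes (u′ , uu′ , u′≢t , big′) =
    u′ , u , t₀ , Adj-sym Tr uu′ , e ∷ p , injective-cons isPath u′∉ , big′
    where
    u′∉ : ¬ (∃ λ i → u′ ≡ lookup (vertices (e ∷ p)) i)
    u′∉ (zero , refl) = edge-≢ uu′ refl
    u′∉ (suc zero , u′≡t) = u′≢t (trans u′≡t (vertices-head p))
    u′∉ (suc (suc i) , u′≡pᵢ) with prefix (e ∷ p) (suc (suc i)) isPath
    ... | q , q-path , _ =
      proj₂ (isTree D) (path+edge⇒cycle Tr q q-path (subst (λ x → Adj Tr x u) u′≡pᵢ (Adj-sym Tr uu′)))
  ... | no none = ⊥-elim (big-branch u branch-small)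
    where
    branch-small : ∀ u′ → Adj Tr u u′ → ¬ Big u′ u
    branch-small u′ uu′ big′ with u′ ≟ t
    ... | yes refl = Big-antisym e big big′
    ... | no  u′≢t = none (u′ , uu′ , u′≢t , big′)

  bigPath : ∀ L → BigPath L
  bigPath zero    = bigPath-start
  bigPath (suc L) = bigPath-extend (bigPath L)

  absurd : ⊥
  absurd with bigPath (m D)
  ... | _ , _ , _ , e , p , isPath , _ = <⇒≱ (path-length< (e ∷ p) isPath) (n≤1+n (m D))

¬¬-∀Fin : ∀ {k} {P : Pred (Fin k) 0ℓ} → (∀ i → ¬ ¬ P i) → ¬ ¬ (∀ i → P i)
¬¬-∀Fin {zero}  _     ¬all = ¬all λ ()
¬¬-∀Fin {suc k} {P} ¬¬P ¬all = ¬¬P zero λ p₀ → ¬¬-∀Fin (¬¬P ∘ suc) λ rest → ¬all (cons p₀ rest)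
  where
  cons : P zero → (∀ i → P (suc i)) → ∀ i → P i
  cons p₀ rest zero    = p₀
  cons p₀ rest (suc i) = rest i

simw≥-of-matchingsAcross : ∀ {n N w′} (H : Graph n) (a : Fin N → Fin n) → Injective _≡_ _≡_ a →
                           2 + 3 * w′ ≤ N → InducedMatchingsAcross H a (suc w′) → SimwAtLeast H (suc w′)
simw≥-of-matchingsAcross H a a-inj N-large matchings j (s≤s j≤w′) (inj₁ n≤1) =
  <⇒≱ (≤-trans (s≤s (s≤s z≤n)) N-large) (≤-trans (injective⇒≤ a-inj) n≤1)
-- The goal is ⊥, so decidability of adjacency and of the sides in the tree may be assumed.
simw≥-of-matchingsAcross H a a-inj N-large matchings j (s≤s j≤w′) (inj₂ (D , narrow)) =
  ¬¬-∀Fin (λ x → ¬¬-∀Fin λ y → ¬¬-excluded-middle) λ Adj? →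
  ¬¬-∀Fin (λ x → ¬¬-∀Fin λ y → ¬¬-∀Fin λ v → ¬¬-excluded-middle) λ Side? →
  BalancedEdge.absurd H a a-inj N-large matchings D j≤w′ narrow Adj? Side?

-- Trees given by a parent function

-- The two neighbours of f i are f (i - 1) and f (i + 1), indices taken modulo j + 3.
cycle-twoNeighbours : ∀ {m} (T : Graph m) {j} (f : Fin (suc (suc (suc j))) → Fin m) →
                      (∀ i → Adj T (f (inject₁ i)) (f (suc i))) → Adj T (f (fromℕ (suc (suc j)))) (f zero) →
                      ∀ i → ∃ λ P → ∃ λ Q → P ≢ Q × Adj T (f i) (f P) × Adj T (f i) (f Q)
cycle-twoNeighbours T {j} f step close i with suc (suc j) ℕ.≟ toℕ i
cycle-twoNeighbours T {j} f step close zero    | yes ()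
cycle-twoNeighbours T {j} f step close (suc i) | yes K≡i+1 =
  inject₁ i , zero , i≢0 , Adj-sym T (step i) , subst (λ x → Adj T (f x) (f zero)) (sym i+1≡K) close
  where
  i+1≡K : suc i ≡ fromℕ (suc (suc j))
  i+1≡K = toℕ-injective (trans (sym K≡i+1) (sym (toℕ-fromℕ _)))
  i≢0 : inject₁ i ≢ zero
  i≢0 eq = ℕ.1+n≢0 (trans (ℕ.suc-injective K≡i+1) (trans (sym (toℕ-inject₁ i)) (cong toℕ eq)))
cycle-twoNeighbours T {j} f step close zero    | no K≢0 =
  fromℕ _ , suc (lower₁ zero K≢0) , K≢1 , Adj-sym T close ,
  subst (λ x → Adj T (f x) (f (suc (lower₁ zero K≢0)))) (inject₁-lower₁ zero K≢0) (step (lower₁ zero K≢0))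
  where
  K≢1 : fromℕ (suc (suc j)) ≢ suc (lower₁ zero K≢0)
  K≢1 eq with trans (sym (toℕ-fromℕ _)) (trans (cong toℕ eq) (cong suc (toℕ-lower₁ zero K≢0)))
  ... | ()
cycle-twoNeighbours T {j} f step close (suc i) | no K≢i+1 =
  inject₁ i , suc (lower₁ (suc i) K≢i+1) , i≢i+2 , Adj-sym T (step i) ,
  subst (λ x → Adj T (f x) (f (suc (lower₁ (suc i) K≢i+1)))) (inject₁-lower₁ (suc i) K≢i+1)
        (step (lower₁ (suc i) K≢i+1))
  where
  i≢i+2 : inject₁ i ≢ suc (lower₁ (suc i) K≢i+1)
  i≢i+2 eq = ℕ.m≢1+n+m (toℕ i) {1}
    (trans (sym (toℕ-inject₁ i)) (trans (cong toℕ eq) (cong suc (toℕ-lower₁ (suc i) K≢i+1))))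

argmax : ∀ {k} (g : Fin (suc k) → ℕ) → ∃ λ i → ∀ i′ → g i′ ≤ g i
argmax {zero}  g = zero , λ { zero → ≤-refl }
argmax {suc k} g with argmax (g ∘ suc)
... | i , max with g zero ≤? g (suc i)
...   | yes ≤max = suc i , λ { zero → ≤max ; (suc i′) → max i′ }
...   | no  ≰max = zero  , λ { zero → ≤-refl ; (suc i′) → ≤-trans (max i′) (≰⇒≥ ≰max) }

module ParentTree {m : ℕ} (parent : Fin m → Fin m) (rank : Fin m → ℕ)
                  (rank-parent : ∀ u → parent u ≢ u → rank (parent u) < rank u)
                  (root : Fin m) (root-unique : ∀ u → parent u ≡ u → u ≡ root) where

  TreeAdj : Fin m → Fin m → Set
  TreeAdj u v = u ≢ v × (parent u ≡ v ⊎ parent v ≡ u)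

  TreeAdj-sym : ∀ {u v} → TreeAdj u v → TreeAdj v u
  TreeAdj-sym (u≢v , up) = u≢v ∘ sym , Data.Sum.swap up

  tree : Graph m
  tree = record { Adj = TreeAdj ; sym = TreeAdj-sym ; irrefl = λ v (v≢v , _) → v≢v refl }

  toRoot : ∀ u → ∃ λ k → Walk TreeAdj k u root
  toRoot u = climb (suc (rank u)) u ≤-refl
    where
    climb : (fuel : ℕ) → ∀ u → rank u < fuel → ∃ λ k → Walk TreeAdj k u root
    climb (suc fuel) u rank<fuel with parent u ≟ u
    ... | yes pu≡u = 0 , subst (Walk TreeAdj 0 u) (root-unique u pu≡u) []
    ... | no  pu≢u with climb fuel (parent u) (≤-trans (rank-parent u pu≢u) (≤-pred rank<fuel))
    ...   | k , p = suc k , (pu≢u ∘ sym , inj₁ refl) ∷ p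

  tree-connected : Connected tree
  tree-connected u v with toRoot u | toRoot v
  ... | k , p | l , q = k + l , p ++ reverseWalk TreeAdj-sym q

  neighbour-parent : ∀ {u v} → TreeAdj u v → rank v ≤ rank u → parent u ≡ v
  neighbour-parent (_   , inj₁ pu≡v) _  = pu≡v
  neighbour-parent {u} {v} (u≢v , inj₂ pv≡u) rv≤ru =
    ⊥-elim (<⇒≱ (subst (_< rank v) (cong rank pv≡u) (rank-parent v (u≢v ∘ trans (sym pv≡u)))) rv≤ru)

  -- The cycle vertex of largest rank would have its two cycle neighbours as parents.
  tree-acyclic : ¬ HasCycle tree
  tree-acyclic (j , f , f-inj , step , close) with argmax (rank ∘ f)
  ... | i , max with cycle-twoNeighbours tree f step close i
  ...   | P , Q , P≢Q , iP , iQ =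
    P≢Q (f-inj (trans (sym (neighbour-parent iP (max P))) (neighbour-parent iQ (max Q))))

  tree-isTree : IsTree tree
  tree-isTree = tree-connected , tree-acyclic

  childless⇒leaf : ∀ t → (∀ c → parent c ≡ t → c ≡ t) → IsLeaf tree t
  childless⇒leaf t childless (f , f-inj , adj) = 0≢1+n (f-inj (trans (to-parent 0F) (sym (to-parent 1F))))
    where
    to-parent : ∀ i → f i ≡ parent t
    to-parent i with adj i
    ... | _     , inj₁ pt≡fi = sym pt≡fi
    ... | t≢fi , inj₂ pfi≡t = ⊥-elim (t≢fi (sym (childless (f i) pfi≡t)))

  module WithChildren (child : Fin m → Fin 2 → Fin m)
                      (is-child : ∀ c → parent c ≢ c → ∃ λ s → c ≡ child (parent c) s) where

    neighbour : Fin m → Fin 3 → Fin m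
    neighbour t zero    = parent t
    neighbour t (suc s) = child t s

    neighbourCode : ∀ {t x} → TreeAdj t x → ∃ λ c → x ≡ neighbour t c
    neighbourCode {t} {x} (t≢x , up) with x ≟ parent t | up
    ... | yes x≡pt | _          = zero , x≡pt
    ... | no  x≢pt | inj₁ pt≡x = ⊥-elim (x≢pt (sym pt≡x))
    ... | no  x≢pt | inj₂ px≡t with is-child x (λ px≡x → t≢x (trans (sym px≡t) px≡x))
    ...   | s , x≡child = suc s , trans x≡child (cong (λ y → child y s) px≡t)

    tree-maxDeg3 : ∀ t → DegAtMost tree 3 t
    tree-maxDeg3 t (f , f-inj , adj)
      with pigeonhole (ℕ.n<1+n 3) (λ i → proj₁ (neighbourCode (adj i)))
    ... | i , i′ , i<i′ , same-code =
      <-irrefl (cong toℕ (f-inj (trans (proj₂ (neighbourCode (adj i)))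
                                       (trans (cong (neighbour t) same-code) (sym (proj₂ (neighbourCode (adj i′)))))))) i<i′

    decomposition : ∀ {n} (δ : Fin n → Fin m) → Injective _≡_ _≡_ δ → (∀ v → IsLeaf tree (δ v)) →
                    (∀ t → IsLeaf tree t → ∃ λ v → δ v ≡ t) → BranchDecomposition n
    decomposition δ δ-inj δ-leaf δ-onto = record
      { m = m ; T = tree ; isTree = tree-isTree ; maxDeg3 = tree-maxDeg3
      ; δ = δ ; δ-inj = δ-inj ; δ-leaf = δ-leaf ; δ-onto = δ-onto }

    -- Below c is the subtree hanging from c, and every edge of G leaving it meets the clique Boundary c.
    module SubtreeCuts {n : ℕ} (G : Graph n) (δ : Fin n → Fin m) (δ-inj : Injective _≡_ _≡_ δ)
                       (δ-leaf : ∀ v → IsLeaf tree (δ v)) (δ-onto : ∀ t → IsLeaf tree t → ∃ λ v → δ v ≡ t)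
                       (Below : Fin m → Pred (Fin m) 0ℓ) (Boundary : Fin m → Pred (Fin n) 0ℓ)
                       (below-self : ∀ c → parent c ≢ c → Below c c)
                       (below-parent : ∀ c → parent c ≢ c → ¬ Below c (parent c))
                       (below-up : ∀ c → parent c ≢ c → ∀ x → Below c x → x ≢ c → Below c (parent x))
                       (below-down : ∀ c → parent c ≢ c → ∀ y → Below c (parent y) → Below c y)
                       (boundary-clique : ∀ c u v → Boundary c u → Boundary c v → u ≢ v → Adj G u v)
                       (boundary-cover : ∀ c → parent c ≢ c → ∀ u v → Adj G u v →
                                         Below c (δ u) → ¬ Below c (δ v) → Boundary c u ⊎ Boundary c v) where

      D : BranchDecomposition n
      D = decomposition δ δ-inj δ-leaf δ-onto

      Side-below : ∀ c → parent c ≢ c → ∀ v → Side D c (parent c) v → Below c (δ v)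
      Side-below c pc≢c = Sides.Side-closed D (Below c) (below-self c pc≢c) step
        where
        step : ∀ {x y} → Below c x → TMinus D c (parent c) x y → Below c y
        step {x} {y} below-x ((_ , inj₂ py≡x) , _) = below-down c pc≢c y (subst (Below c) (sym py≡x) below-x)
        step {x} {y} below-x ((_ , inj₁ px≡y) , not-cpc , _) with x ≟ c
        ... | yes refl = ⊥-elim (not-cpc (refl , sym px≡y))
        ... | no  x≢c  = subst (Below c) px≡y (below-up c pc≢c x below-x x≢c)

      Side-above : ∀ c → parent c ≢ c → ∀ v → Side D (parent c) c v → ¬ Below c (δ v)
      Side-above c pc≢c = Sides.Side-closed D (λ x → ¬ Below c x) (below-parent c pc≢c) step
        where
        step : ∀ {x y} → ¬ Below c x → TMinus D (parent c) c x y → ¬ Below c y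
        step {x} {y} ¬below-x ((_ , inj₁ px≡y) , _) below-y =
          ¬below-x (below-down c pc≢c x (subst (Below c) (sym px≡y) below-y))
        step {x} {y} ¬below-x ((_ , inj₂ py≡x) , not-pcc , _) below-y with y ≟ c
        ... | yes refl = not-pcc (sym py≡x , refl)
        ... | no  y≢c  = ¬below-x (subst (Below c) py≡x (below-up c pc≢c y below-y y≢c))

      decomposition-cutsim≤1 : ∀ a b → TreeAdj a b → CutsimAtMost G (Side D a b) 1
      decomposition-cutsim≤1 a _ ab@(a≢pa , inj₁ refl) =
        cutsim≤1-of-cliqueCover G _ (Boundary a) (boundary-clique a) cover
        where
        cover : ∀ u v → Adj G u v → Side D a (parent a) u → ¬ Side D a (parent a) v → Boundary a u ⊎ Boundary a v
        cover u v uv u-below v-outside with Sides.Side-total D ab v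
        ... | inj₁ v-below = ⊥-elim (v-outside v-below)
        ... | inj₂ v-above =
          boundary-cover a (a≢pa ∘ sym) u v uv (Side-below a (a≢pa ∘ sym) u u-below)
                                             (Side-above a (a≢pa ∘ sym) v v-above)
      decomposition-cutsim≤1 _ b ab@(pb≢b , inj₂ refl) =
        cutsim≤1-of-cliqueCover G _ (Boundary b) (boundary-clique b) cover
        where
        cover : ∀ u v → Adj G u v → Side D (parent b) b u → ¬ Side D (parent b) b v → Boundary b u ⊎ Boundary b v
        cover u v uv u-above v-outside with Sides.Side-total D ab v
        ... | inj₁ v-above = ⊥-elim (v-outside v-above)
        ... | inj₂ v-below =
          Data.Sum.swap (boundary-cover b pb≢b v u (Adj-sym G uv) (Side-below b pb≢b v v-below)
                                                            (Side-above b pb≢b u u-above))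

-- The construction

module Encoding {A : Set} {k : ℕ} (A↔Fin : A ↔ Fin k) where

  open Inverse A↔Fin public using ()
    renaming (to to encode; from to decode; strictlyInverseʳ to decode-encode; strictlyInverseˡ to encode-decode)

  encode-injective : Injective _≡_ _≡_ encode
  encode-injective {x} {y} eq = trans (sym (decode-encode x)) (trans (cong decode eq) (decode-encode y))

  decode-injective : Injective _≡_ _≡_ decode
  decode-injective {i} {j} eq = trans (sym (encode-decode i)) (trans (cong encode eq) (encode-decode j))

  _≟ᵉ_ : (x y : A) → Dec (x ≡ y)
  x ≟ᵉ y = map′ encode-injective (cong encode) (encode x ≟ encode y)

module Construction (N′ h : ℕ) where

  N H : ℕ
  N = suc N′
  H = suc h

  Base : Set
  Base = Fin N ⊎ Fin N × Fin N ⊎ Bool × Fin N × Fin N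

  pattern A i     = inj₁ i
  pattern S i j   = inj₂ (inj₁ (i , j))
  pattern K b i j = inj₂ (inj₂ (b , i , j))

  -- K b i j is the vertex of the clique joining S i j to A i (b = true) or to A j (b = false).
  hand : Bool → Fin N → Fin N → Fin N
  hand true  i j = i
  hand false i j = j

  BaseAdj : Base → Base → Set
  BaseAdj (A l)     (K b i j)    = l ≡ hand b i j
  BaseAdj (S i′ j′) (K b i j)    = i′ ≡ i × j′ ≡ j
  BaseAdj (K b i j) (A l)        = l ≡ hand b i j
  BaseAdj (K b i j) (S i′ j′)    = i′ ≡ i × j′ ≡ j
  BaseAdj (K b i j) (K b′ i′ j′) = _≢_ {A = Base} (K b i j) (K b′ i′ j′)
  BaseAdj _         _            = ⊥

  BaseAdj-sym : ∀ x y → BaseAdj x y → BaseAdj y x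
  BaseAdj-sym (A _)     (K _ _ _) xy = xy
  BaseAdj-sym (S _ _)   (K _ _ _) xy = xy
  BaseAdj-sym (K _ _ _) (A _)     xy = xy
  BaseAdj-sym (K _ _ _) (S _ _)   xy = xy
  BaseAdj-sym (K _ _ _) (K _ _ _) xy = xy ∘ sym

  BaseAdj-irrefl : ∀ x → ¬ BaseAdj x x
  BaseAdj-irrefl (K _ _ _) x≢x = x≢x refl

  InK : Base → Set
  InK (K _ _ _) = ⊤
  InK _         = ⊥

  BaseAdj-split : ∀ x y → BaseAdj x y → InK x ⊎ InK y
  BaseAdj-split (A _)     (K _ _ _) _ = inj₂ tt
  BaseAdj-split (S _ _)   (K _ _ _) _ = inj₂ tt
  BaseAdj-split (K _ _ _) _         _ = inj₁ tt

  M : ℕ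
  M = N + (N * N + 2 * (N * N))

  opaque
    Base↔Fin : Base ↔ Fin M
    Base↔Fin = ↔-sym ((↔-refl ⊎-↔ ((*↔× ⊎-↔ ((2↔Bool ×-↔ *↔×) ↔-∘ *↔×)) ↔-∘ +↔⊎)) ↔-∘ +↔⊎)

  open Encoding Base↔Fin using () renaming
    (encode to encodeᴮ; decode to decodeᴮ; decode-encode to decode-encodeᴮ; encode-decode to encode-decodeᴮ;
     _≟ᵉ_ to _≟ᴮ_)

  BaseAdj? : ∀ x y → Dec (BaseAdj x y)
  BaseAdj? (A l)     (K b i j)    = l ≟ hand b i j
  BaseAdj? (S i′ j′) (K b i j)    = (i′ ≟ i) ×-dec (j′ ≟ j)
  BaseAdj? (K b i j) (A l)        = l ≟ hand b i j
  BaseAdj? (K b i j) (S i′ j′)    = (i′ ≟ i) ×-dec (j′ ≟ j)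
  BaseAdj? (K b i j) (K b′ i′ j′) = ¬? (K b i j ≟ᴮ K b′ i′ j′)
  BaseAdj? (A _)     (A _)        = no λ ()
  BaseAdj? (A _)     (S _ _)      = no λ ()
  BaseAdj? (S _ _)   (A _)        = no λ ()
  BaseAdj? (S _ _)   (S _ _)      = no λ ()

  -- G: the base graph with a pendant path of h edges hung from every vertex; vertex (x , d) is at
  -- depth d on the path of x.
  Vertex : Set
  Vertex = Base × Fin H

  VertexAdj : Vertex → Vertex → Set
  VertexAdj (x , d) (y , d′) = x ≡ y × (toℕ d′ ≡ suc (toℕ d) ⊎ toℕ d ≡ suc (toℕ d′))
                             ⊎ d ≡ zero × d′ ≡ zero × BaseAdj x y

  VertexAdj-sym : ∀ u v → VertexAdj u v → VertexAdj v u
  VertexAdj-sym _       _       (inj₁ (refl , deeper))  = inj₁ (refl , Data.Sum.swap deeper)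
  VertexAdj-sym (x , _) (y , _) (inj₂ (d≡0 , d′≡0 , xy)) = inj₂ (d′≡0 , d≡0 , BaseAdj-sym x y xy)

  VertexAdj-irrefl : ∀ v → ¬ VertexAdj v v
  VertexAdj-irrefl _       (inj₁ (_ , inj₁ eq))   = ℕ.1+n≢n (sym eq)
  VertexAdj-irrefl _       (inj₁ (_ , inj₂ eq))   = ℕ.1+n≢n (sym eq)
  VertexAdj-irrefl (x , _) (inj₂ (_ , _ , xx))  = BaseAdj-irrefl x xx

  n : ℕ
  n = M * H

  opaque
    Vertex↔Fin : Vertex ↔ Fin n
    Vertex↔Fin = ↔-sym *↔× ↔-∘ (Base↔Fin ×-↔ ↔-refl)

  open Encoding Vertex↔Fin using (encode; decode; decode-encode; encode-injective; decode-injective)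

  G : Graph n
  G = record { Adj = λ u v → VertexAdj (decode u) (decode v)
             ; sym = λ {u} {v} → VertexAdj-sym (decode u) (decode v)
             ; irrefl = λ v → VertexAdj-irrefl (decode v) }

  vertex : Base → Fin H → Fin n
  vertex x d = encode (x , d)

  top : Base → Fin n
  top x = vertex x (fromℕ h)

  top-injective : ∀ {x y} → top x ≡ top y → x ≡ y
  top-injective eq = cong proj₁ (encode-injective eq)

  edge : ∀ {u v} → VertexAdj u v → Adj G (encode u) (encode v)
  edge {u} {v} = subst₂ VertexAdj (sym (decode-encode u)) (sym (decode-encode v))

  descend : ∀ x d (d<H : d < H) → Walk (Adj G) d (vertex x (fromℕ< d<H)) (vertex x zero)
  descend x zero    _   = []
  descend x (suc d) d<H = edge (inj₁ (refl , inj₂ (trans (toℕ-fromℕ< d<H) (cong suc (sym (toℕ-fromℕ< d<H′))))))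
                          ∷ descend x d d<H′
    where
    d<H′ : d < H
    d<H′ = <-trans (ℕ.n<1+n d) d<H

  descend-top : ∀ x → Walk (Adj G) h (top x) (vertex x zero)
  descend-top x = subst (λ d → Walk (Adj G) h (vertex x d) (vertex x zero)) (sym (fromℕ-def h)) (descend x h ≤-refl)

  r : ℕ
  r = H + H

  -- Down the path of x, across c, and up the path of y: h + 2 + h = r edges.
  reach : ∀ {x c y} → BaseAdj x c → BaseAdj c y → DistAtMost G r (top x) (top y)
  reach xc cy = _ , ≤-reflexive (+-suc h H) ,
    descend-top _ ++ (edge (inj₂ (refl , refl , xc)) ∷ edge (inj₂ (refl , refl , cy)) ∷
                      reverseWalk (Adj-sym G) (descend-top _))

  A-close-S : ∀ i j → PowerAdj G r (top (A i)) (top (S i j))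
  A-close-S i j = (λ eq → case-A≢S (top-injective eq)) , reach {c = K true i j} refl (refl , refl)
    where
    case-A≢S : _≢_ {A = Base} (A i) (S i j)
    case-A≢S ()

  S-close-A : ∀ i j → PowerAdj G r (top (S i j)) (top (A j))
  S-close-A i j = (λ eq → case-S≢A (top-injective eq)) , reach {c = K false i j} (refl , refl) refl
    where
    case-S≢A : _≢_ {A = Base} (S i j) (A j)
    case-S≢A ()

  HasIndex : Base → Fin N → Set
  HasIndex (A i)     l = l ≡ i
  HasIndex (S i j)   l = l ≡ i ⊎ l ≡ j
  HasIndex (K _ _ _) l = ⊥

  HasIndex? : ∀ x l → Dec (HasIndex x l)
  HasIndex? (A i)     l = l ≟ i
  HasIndex? (S i j)   l = (l ≟ i) ⊎-dec (l ≟ j)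
  HasIndex? (K _ _ _) l = no λ ()

  Share : Base → Base → Set
  Share x y = ∃ λ l → HasIndex x l × HasIndex y l

  InK? : ∀ x → Dec (InK x)
  InK? (A _)     = no λ ()
  InK? (S _ _)   = no λ ()
  InK? (K _ _ _) = yes tt

  Near : Base → Base → Set
  Near s₀ x = InK x ⊎ Share s₀ x

  Near? : ∀ s₀ x → Dec (Near s₀ x)
  Near? s₀ x = InK? x ⊎-dec any? λ l → HasIndex? s₀ l ×-dec HasIndex? x l

  hand-index : ∀ x b i j → BaseAdj x (K b i j) → ¬ InK x → HasIndex x (hand b i j)
  hand-index (A _)     _     _ _ l≡hand      _   = sym l≡hand
  hand-index (S _ _)   true  _ _ (refl , _) _   = inj₁ refl
  hand-index (S _ _)   false _ _ (_ , refl) _   = inj₂ refl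
  hand-index (K _ _ _) _     _ _ _           ∉K = ⊥-elim (∉K tt)

  common-neighbour⇒Share : ∀ {x y c} → ¬ InK x → ¬ InK y → BaseAdj x c → BaseAdj y c → Share x y
  common-neighbour⇒Share {x} {y} {c} x∉K y∉K xc yc with BaseAdj-split x c xc
  ... | inj₁ x∈K = ⊥-elim (x∉K x∈K)
  ... | inj₂ c∈K with c | c∈K
  ...   | K b i j | _ = hand b i j , hand-index x b i j xc x∉K , hand-index y b i j yc y∉K

  choose : ∀ {P : Set} → Dec P → ℕ → ℕ → ℕ
  choose (yes _) m _ = m
  choose (no  _) _ m = m

  choose-yes : ∀ {P : Set} (d : Dec P) {m m′} → P → choose d m m′ ≡ m
  choose-yes (yes _) _ = refl
  choose-yes (no ¬p) p = ⊥-elim (¬p p)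

  choose-no : ∀ {P : Set} (d : Dec P) {m m′} → ¬ P → choose d m m′ ≡ m′
  choose-no (yes p) ¬p = ⊥-elim (¬p p)
  choose-no (no _)  _  = refl

  -- A lower bound for the distance from s₀ to x in the base graph, exact when s₀ ∉ K.
  ρ : Base → Base → ℕ
  ρ s₀ x = choose (x ≟ᴮ s₀) 0 (choose (BaseAdj? s₀ x) 1 (choose (Near? s₀ x) 2 3))

  ρ-self : ∀ s₀ → ρ s₀ s₀ ≡ 0
  ρ-self s₀ = choose-yes (s₀ ≟ᴮ s₀) refl

  ρ≤1 : ∀ s₀ x → BaseAdj s₀ x → ρ s₀ x ≤ 1
  ρ≤1 s₀ x s₀x with x ≟ᴮ s₀ | BaseAdj? s₀ x
  ... | yes _ | _       = z≤n
  ... | no  _ | yes _   = ≤-refl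
  ... | no  _ | no ¬s₀x = ⊥-elim (¬s₀x s₀x)

  ρ≤2 : ∀ s₀ x → Near s₀ x → ρ s₀ x ≤ 2
  ρ≤2 s₀ x near with x ≟ᴮ s₀ | BaseAdj? s₀ x | Near? s₀ x
  ... | yes _ | _     | _       = z≤n
  ... | no  _ | yes _ | _       = s≤s z≤n
  ... | no  _ | no  _ | yes _   = ≤-refl
  ... | no  _ | no  _ | no ¬near = ⊥-elim (¬near near)

  ρ≥1 : ∀ s₀ x → x ≢ s₀ → 1 ≤ ρ s₀ x
  ρ≥1 s₀ x x≢s₀ with x ≟ᴮ s₀ | BaseAdj? s₀ x | Near? s₀ x
  ... | yes x≡s₀ | _     | _     = ⊥-elim (x≢s₀ x≡s₀)
  ... | no  _    | yes _ | _     = ≤-refl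
  ... | no  _    | no  _ | yes _ = s≤s z≤n
  ... | no  _    | no  _ | no  _ = s≤s z≤n

  ρ≥2 : ∀ s₀ x → x ≢ s₀ → ¬ BaseAdj s₀ x → 2 ≤ ρ s₀ x
  ρ≥2 s₀ x x≢s₀ ¬s₀x with x ≟ᴮ s₀ | BaseAdj? s₀ x | Near? s₀ x
  ... | yes x≡s₀ | _       | _     = ⊥-elim (x≢s₀ x≡s₀)
  ... | no  _    | yes s₀x | _     = ⊥-elim (¬s₀x s₀x)
  ... | no  _    | no  _   | yes _ = ≤-refl
  ... | no  _    | no  _   | no  _ = s≤s (s≤s z≤n)

  ρ≥3 : ∀ s₀ x → x ≢ s₀ → ¬ BaseAdj s₀ x → ¬ Near s₀ x → 3 ≤ ρ s₀ x
  ρ≥3 s₀ x x≢s₀ ¬s₀x ¬near with x ≟ᴮ s₀ | BaseAdj? s₀ x | Near? s₀ x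
  ... | yes x≡s₀ | _       | _        = ⊥-elim (x≢s₀ x≡s₀)
  ... | no  _    | yes s₀x | _        = ⊥-elim (¬s₀x s₀x)
  ... | no  _    | no  _   | yes near = ⊥-elim (¬near near)
  ... | no  _    | no  _   | no  _    = ≤-refl

  ρ≤3 : ∀ s₀ x → ρ s₀ x ≤ 3
  ρ≤3 s₀ x with x ≟ᴮ s₀ | BaseAdj? s₀ x | Near? s₀ x
  ... | yes _ | _     | _     = z≤n
  ... | no  _ | yes _ | _     = s≤s z≤n
  ... | no  _ | no  _ | yes _ = s≤s (s≤s z≤n)
  ... | no  _ | no  _ | no  _ = ≤-refl

  ρ-lipschitz : ∀ s₀ → ¬ InK s₀ → ∀ x y → BaseAdj x y → ρ s₀ y ≤ suc (ρ s₀ x)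
  ρ-lipschitz s₀ s₀∉K x y xy = by-cases (y ≟ᴮ s₀) (x ≟ᴮ s₀) (InK? y) (BaseAdj? s₀ x)
    where
    by-cases : Dec (y ≡ s₀) → Dec (x ≡ s₀) → Dec (InK y) → Dec (BaseAdj s₀ x) → ρ s₀ y ≤ suc (ρ s₀ x)
    by-cases (yes y≡s₀) _ _ _ = ≤-trans (≤-reflexive (trans (cong (ρ s₀) y≡s₀) (ρ-self s₀))) z≤n
    by-cases (no _) (yes x≡s₀) _ _ = ≤-trans (ρ≤1 s₀ y (subst (λ z → BaseAdj z y) x≡s₀ xy)) (s≤s z≤n)
    by-cases (no _) (no x≢s₀) (yes y∈K) _ = ≤-trans (ρ≤2 s₀ y (inj₁ y∈K)) (s≤s (ρ≥1 s₀ x x≢s₀))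
    by-cases (no _) (no x≢s₀) (no y∉K) (yes s₀x) =
      ≤-trans (ρ≤2 s₀ y (inj₂ (common-neighbour⇒Share s₀∉K y∉K s₀x (BaseAdj-sym x y xy))))
              (s≤s (ρ≥1 s₀ x x≢s₀))
    by-cases (no _) (no x≢s₀) (no y∉K) (no ¬s₀x) = ≤-trans (ρ≤3 s₀ y) (s≤s (ρ≥2 s₀ x x≢s₀ ¬s₀x))

  ψ : Base → Vertex → ℕ
  ψ s₀ (x , d) = choose (x ≟ᴮ s₀) (h ∸ toℕ d) (h + ρ s₀ x + toℕ d)

  ψ-floor : ∀ s₀ x → ψ s₀ (x , zero) ≡ h + ρ s₀ x
  ψ-floor s₀ x with x ≟ᴮ s₀
  ... | yes refl = sym (+-identityʳ h)
  ... | no  _    = +-identityʳ _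

  ψ-lipschitz : ∀ s₀ → ¬ InK s₀ → ∀ u v → VertexAdj u v → ψ s₀ v ≤ suc (ψ s₀ u)
  ψ-lipschitz s₀ _ (x , d) (_ , d′) (inj₁ (refl , deeper)) with x ≟ᴮ s₀ | deeper
  ... | yes _ | inj₁ d′≡d+1 rewrite d′≡d+1 = ≤-trans (∸-monoʳ-≤ h (n≤1+n (toℕ d))) (n≤1+n _)
  ... | yes _ | inj₂ d≡d′+1 rewrite d≡d′+1 = ∸≤suc∸suc h (toℕ d′)
    where
    ∸≤suc∸suc : ∀ m k → m ∸ k ≤ suc (m ∸ suc k)
    ∸≤suc∸suc zero    k       = ≤-trans (≤-reflexive (0∸n≡0 k)) z≤n
    ∸≤suc∸suc (suc m) zero    = s≤s (≤-reflexive refl)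
    ∸≤suc∸suc (suc m) (suc k) = ∸≤suc∸suc m k
  ... | no  _ | inj₁ d′≡d+1 rewrite d′≡d+1 = ≤-reflexive (+-suc _ (toℕ d))
  ... | no  _ | inj₂ d≡d′+1 rewrite d≡d′+1 = ≤-trans (+-monoʳ-≤ _ (n≤1+n (toℕ d′))) (n≤1+n _)
  ψ-lipschitz s₀ s₀∉K (x , _) (y , _) (inj₂ (refl , refl , xy)) rewrite ψ-floor s₀ x | ψ-floor s₀ y =
    ≤-trans (+-monoʳ-≤ h (ρ-lipschitz s₀ s₀∉K x y xy)) (≤-reflexive (+-suc h (ρ s₀ x)))

  ψ-walk : ∀ s₀ → ¬ InK s₀ → ∀ {k u v} → Walk (Adj G) k u v → ψ s₀ (decode v) ≤ k + ψ s₀ (decode u)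
  ψ-walk s₀ s₀∉K []                    = ≤-refl
  ψ-walk s₀ s₀∉K {u = u} (_∷_ {w = w} e p) =
    ≤-trans (ψ-walk s₀ s₀∉K p)
            (≤-trans (+-monoʳ-≤ _ (ψ-lipschitz s₀ s₀∉K (decode u) (decode w) e)) (≤-reflexive (+-suc _ _)))

  -- ψ s₀ climbs from 0 at top s₀ to at least h + 3 + h = r + 1 at top s.
  far-apart : ∀ {s₀ s} → ¬ InK s₀ → ¬ InK s → s ≢ s₀ → ¬ Share s₀ s → ¬ DistAtMost G r (top s₀) (top s)
  far-apart {s₀} {s} s₀∉K s∉K s≢s₀ ¬share (k , k≤r , p) = <⇒≱ (s≤s ≤-refl) (begin
    suc r                                  ≡⟨ r+1≡h+3+h h ⟨
    h + 3 + h                              ≤⟨ +-monoˡ-≤ h (+-monoʳ-≤ h (ρ≥3 s₀ s s≢s₀ ¬adjacent ¬near)) ⟩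
    h + ρ s₀ s + h                         ≡⟨ ψ-top ⟨
    ψ s₀ (s , fromℕ h)                     ≡⟨ cong (ψ s₀) (decode-encode _) ⟨
    ψ s₀ (decode (top s))                  ≤⟨ ψ-walk s₀ s₀∉K p ⟩
    k + ψ s₀ (decode (top s₀))             ≡⟨ cong (λ v → k + ψ s₀ v) (decode-encode _) ⟩
    k + ψ s₀ (s₀ , fromℕ h)                ≡⟨ cong (k +_) ψ-top-self ⟩
    k + 0                                  ≡⟨ +-identityʳ k ⟩
    k                                      ≤⟨ k≤r ⟩
    r                                      ∎)
    where
    open ≤-Reasoning
    r+1≡h+3+h : ∀ h → h + 3 + h ≡ suc (suc h + suc h)
    r+1≡h+3+h = solve-∀
    ¬adjacent : ¬ BaseAdj s₀ s
    ¬adjacent s₀s = [ s₀∉K , s∉K ]′ (BaseAdj-split s₀ s s₀s)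
    ¬near : ¬ Near s₀ s
    ¬near = [ s∉K , ¬share ]′
    ψ-top : ψ s₀ (s , fromℕ h) ≡ h + ρ s₀ s + h
    ψ-top = trans (choose-no (s ≟ᴮ s₀) s≢s₀) (cong (h + ρ s₀ s +_) (toℕ-fromℕ h))
    ψ-top-self : ψ s₀ (s₀ , fromℕ h) ≡ 0
    ψ-top-self = trans (choose-yes (s₀ ≟ᴮ s₀) refl) (trans (cong (h ∸_) (toℕ-fromℕ h)) (n∸n≡0 h))

  Member : Fin N → Fin N → Base → Set
  Member i j z = ¬ InK z × (∀ l → HasIndex z l → l ≡ i ⊎ l ≡ j)

  Apart : Fin N → Fin N → Fin N → Fin N → Set
  Apart i j i′ j′ = ∀ l → l ≡ i ⊎ l ≡ j → ¬ (l ≡ i′ ⊎ l ≡ j′)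

  module _ {i j i′ j′ z z′} (z-member : Member i j z) (z′-member : Member i′ j′ z′) (apart : Apart i j i′ j′) where

    members-unshared : ¬ Share z z′
    members-unshared (l , zl , z′l) = apart l (proj₂ z-member l zl) (proj₂ z′-member l z′l)

    members-distinct : z ≢ z′
    members-distinct refl = members-unshared (someIndex z (proj₁ z-member))
      where
      someIndex : ∀ z → ¬ InK z → ∃ λ l → HasIndex z l × HasIndex z l
      someIndex (A i)     _   = i , refl , refl
      someIndex (S i _)   _   = i , inj₁ refl , inj₁ refl
      someIndex (K _ _ _) z∉K = ⊥-elim (z∉K tt)

    members-far : ¬ PowerAdj G r (top z) (top z′)
    members-far (_ , close) = far-apart (proj₁ z-member) (proj₁ z′-member) (members-distinct ∘ sym) members-unshared close

  A-member : ∀ i j → Member i j (A i)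
  A-member i j = (λ ()) , λ _ → inj₁

  S-member : ∀ i j → Member i j (S i j)
  S-member i j = (λ ()) , λ _ l∈ → l∈

  A′-member : ∀ i j → Member i j (A j)
  A′-member i j = (λ ()) , λ _ → inj₂

  record CrossingPair (X : Pred (Fin n) 0ℓ) (i j : Fin N) : Set where
    field
      inner outer  : Base
      inner∈X      : X (top inner)
      outer∉X      : ¬ X (top outer)
      close        : PowerAdj G r (top inner) (top outer)
      inner-member : Member i j inner
      outer-member : Member i j outer

  -- With A i inside X and A j outside, one of the G^r edges A i — S i j — A j crosses X.
  crossingPair : ∀ (X : Pred (Fin n) 0ℓ) → Decidable X → ∀ i j → X (top (A i)) → ¬ X (top (A j)) → CrossingPair X i j
  crossingPair X X? i j ai∈X aj∉X with X? (top (S i j))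
  ... | yes s∈X = record { inner = S i j ; outer = A j ; inner∈X = s∈X ; outer∉X = aj∉X ; close = S-close-A i j
                         ; inner-member = S-member i j ; outer-member = A′-member i j }
  ... | no  s∉X = record { inner = A i ; outer = S i j ; inner∈X = ai∈X ; outer∉X = s∉X ; close = A-close-S i j
                         ; inner-member = A-member i j ; outer-member = S-member i j }

  matchingsAcross : ∀ w → InducedMatchingsAcross (power G r) (top ∘ A) w
  matchingsAcross w X X? e₁ e₂ e₁-inj e₂-inj inside outside =
    top ∘ inner ∘ pair , top ∘ outer ∘ pair , inner∈X ∘ pair , outer∉X ∘ pair , close ∘ pair ,
    injective (inner ∘ pair) (inner-member ∘ pair) , injective (outer ∘ pair) (outer-member ∘ pair) ,
    λ t t′ t≢t′ →
      members-far (inner-member (pair t)) (inner-member (pair t′)) (apart t≢t′) ,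
      members-far (inner-member (pair t)) (outer-member (pair t′)) (apart t≢t′) ,
      members-far (outer-member (pair t)) (inner-member (pair t′)) (apart t≢t′) ,
      members-far (outer-member (pair t)) (outer-member (pair t′)) (apart t≢t′)
    where
    open CrossingPair
    pair : ∀ t → CrossingPair X (e₁ t) (e₂ t)
    pair t = crossingPair X X? (e₁ t) (e₂ t) (inside t) (outside t)
    apart : ∀ {t t′} → t ≢ t′ → Apart (e₁ t) (e₂ t) (e₁ t′) (e₂ t′)
    apart t≢t′ l (inj₁ l≡e₁t) (inj₁ l≡e₁t′) = t≢t′ (e₁-inj (trans (sym l≡e₁t) l≡e₁t′))
    apart {t} {t′} _ l (inj₁ l≡e₁t) (inj₂ l≡e₂t′) =
      outside t′ (subst (X ∘ top ∘ A) (trans (sym l≡e₁t) l≡e₂t′) (inside t))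
    apart {t} {t′} _ l (inj₂ l≡e₂t) (inj₁ l≡e₁t′) =
      outside t (subst (X ∘ top ∘ A) (trans (sym l≡e₁t′) l≡e₂t) (inside t′))
    apart t≢t′ l (inj₂ l≡e₂t) (inj₂ l≡e₂t′) = t≢t′ (e₂-inj (trans (sym l≡e₂t) l≡e₂t′))
    injective : (f : Fin w → Base) → (∀ t → Member (e₁ t) (e₂ t) (f t)) → Injective _≡_ _≡_ (top ∘ f)
    injective f member {t} {t′} eq with t ≟ t′
    ... | yes t≡t′ = t≡t′
    ... | no  t≢t′ = ⊥-elim (members-distinct (member t) (member t′) (apart t≢t′) (top-injective eq))

  -- The branch decomposition of G: a caterpillar whose spine runs through the base vertices in
  -- the order of Fin M, with a stem for each base vertex carrying one leaf per depth.
  TreeVertex : Set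
  TreeVertex = Fin M ⊎ Vertex ⊎ Vertex

  pattern spine z  = inj₁ z
  pattern stem x d = inj₂ (inj₁ (x , d))
  pattern leaf x d = inj₂ (inj₂ (x , d))

  parentᵀ : TreeVertex → TreeVertex
  parentᵀ (spine zero)     = spine zero
  parentᵀ (spine (suc z))  = spine (inject₁ z)
  parentᵀ (stem x zero)    = spine (encodeᴮ x)
  parentᵀ (stem x (suc d)) = stem x (inject₁ d)
  parentᵀ (leaf x d)       = stem x d

  rankᵀ : TreeVertex → ℕ
  rankᵀ (spine z)  = toℕ z
  rankᵀ (stem _ d) = M + suc (toℕ d)
  rankᵀ (leaf _ d) = M + suc (suc (toℕ d))

  rankᵀ-parent : ∀ t → parentᵀ t ≢ t → rankᵀ (parentᵀ t) < rankᵀ t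
  rankᵀ-parent (spine zero)     root = ⊥-elim (root refl)
  rankᵀ-parent (spine (suc z))  _    = s≤s (≤-reflexive (toℕ-inject₁ z))
  rankᵀ-parent (stem x zero)    _    = ≤-trans (toℕ<n (encodeᴮ x)) (m≤m+n M 1)
  rankᵀ-parent (stem x (suc d)) _    = +-monoʳ-< M (s≤s (s≤s (≤-reflexive (toℕ-inject₁ d))))
  rankᵀ-parent (leaf x d)       _    = +-monoʳ-< M ≤-refl

  inject₁≢suc : ∀ {k} (z : Fin k) → inject₁ z ≢ suc z
  inject₁≢suc z eq = ℕ.1+n≢n (sym (trans (sym (toℕ-inject₁ z)) (cong toℕ eq)))

  rootᵀ-unique : ∀ t → parentᵀ t ≡ t → t ≡ spine zero
  rootᵀ-unique (spine zero)     _  = refl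
  rootᵀ-unique (spine (suc z))  eq = ⊥-elim (inject₁≢suc z (inj₁-injective eq))
  rootᵀ-unique (stem x (suc d)) eq =
    ⊥-elim (inject₁≢suc d (cong proj₂ (inj₁-injective (inj₂-injective eq))))

  nextSpine : Fin M → TreeVertex
  nextSpine z with suc (toℕ z) ℕ.<? M
  ... | yes z+1<M = spine (fromℕ< z+1<M)
  ... | no  _     = spine z

  nextStem : Base → Fin H → TreeVertex
  nextStem x d with suc (toℕ d) ℕ.<? H
  ... | yes d+1<H = stem x (fromℕ< d+1<H)
  ... | no  _     = stem x d

  childᵀ : TreeVertex → Fin 2 → TreeVertex
  childᵀ (spine z)  zero    = stem (decodeᴮ z) zero
  childᵀ (spine z)  (suc _) = nextSpine z
  childᵀ (stem x d) zero    = leaf x d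
  childᵀ (stem x d) (suc _) = nextStem x d
  childᵀ (leaf x d) _       = leaf x d

  is-childᵀ : ∀ c → parentᵀ c ≢ c → ∃ λ s → c ≡ childᵀ (parentᵀ c) s
  is-childᵀ (spine zero)     root = ⊥-elim (root refl)
  is-childᵀ (spine (suc z))  _    = 1F , sym next
    where
    next : nextSpine (inject₁ z) ≡ spine (suc z)
    next with suc (toℕ (inject₁ z)) ℕ.<? M
    ... | yes lt = cong spine (toℕ-injective (trans (toℕ-fromℕ< lt) (cong suc (toℕ-inject₁ z))))
    ... | no ¬lt = ⊥-elim (¬lt (subst (λ k → suc k < M) (sym (toℕ-inject₁ z)) (toℕ<n (suc z))))
  is-childᵀ (stem x zero)    _    = 0F , cong (λ y → stem y zero) (sym (decode-encodeᴮ x))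
  is-childᵀ (stem x (suc d)) _    = 1F , sym next
    where
    next : nextStem x (inject₁ d) ≡ stem x (suc d)
    next with suc (toℕ (inject₁ d)) ℕ.<? H
    ... | yes lt = cong (stem x) (toℕ-injective (trans (toℕ-fromℕ< lt) (cong suc (toℕ-inject₁ d))))
    ... | no ¬lt = ⊥-elim (¬lt (subst (λ k → suc k < H) (sym (toℕ-inject₁ d)) (toℕ<n (suc d))))
  is-childᵀ (leaf x d)       _    = 0F , refl

  position : TreeVertex → ℕ
  position (spine z)  = toℕ z
  position (stem x _) = toℕ (encodeᴮ x)
  position (leaf x _) = toℕ (encodeᴮ x)

  Belowᵀ : TreeVertex → TreeVertex → Set
  Belowᵀ (spine z)  t           = toℕ z ≤ position t
  Belowᵀ (stem x d) (stem y d′) = y ≡ x × toℕ d ≤ toℕ d′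
  Belowᵀ (stem x d) (leaf y d′) = y ≡ x × toℕ d ≤ toℕ d′
  Belowᵀ (stem x d) (spine _)   = ⊥
  Belowᵀ (leaf x d) t           = t ≡ leaf x d

  belowᵀ-self : ∀ c → Belowᵀ c c
  belowᵀ-self (spine _)  = ≤-refl
  belowᵀ-self (stem _ _) = refl , ≤-refl
  belowᵀ-self (leaf _ _) = refl

  belowᵀ-parent : ∀ c → parentᵀ c ≢ c → ¬ Belowᵀ c (parentᵀ c)
  belowᵀ-parent (spine zero)     root _   = root refl
  belowᵀ-parent (spine (suc z))  _    z<z = ℕ.1+n≰n (subst (suc (toℕ z) ≤_) (toℕ-inject₁ z) z<z)
  belowᵀ-parent (stem x (suc d)) _    (_ , d<d) = ℕ.1+n≰n (subst (suc (toℕ d) ≤_) (toℕ-inject₁ d) d<d)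
  belowᵀ-parent (leaf x d)       _    ()

  belowᵀ-up : ∀ c t → Belowᵀ c t → t ≢ c → Belowᵀ c (parentᵀ t)
  belowᵀ-up (spine z)  (spine zero)      z≤0       t≢c =
    ⊥-elim (t≢c (cong spine (toℕ-injective (sym (ℕ.n≤0⇒n≡0 z≤0)))))
  belowᵀ-up (spine z)  (spine (suc z′))  z≤z′+1    t≢c =
    subst (toℕ z ≤_) (sym (toℕ-inject₁ z′))
          (ℕ.≤-pred (ℕ.≤∧≢⇒< z≤z′+1 (t≢c ∘ cong spine ∘ sym ∘ toℕ-injective)))
  belowᵀ-up (spine z)  (stem x zero)     z≤x       _   = z≤x
  belowᵀ-up (spine z)  (stem x (suc d))  z≤x       _   = z≤x
  belowᵀ-up (spine z)  (leaf x d)        z≤x       _   = z≤x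
  belowᵀ-up (stem x d) (stem .x zero)    (refl , d≤0) t≢c =
    ⊥-elim (t≢c (cong (stem x) (toℕ-injective (sym (ℕ.n≤0⇒n≡0 d≤0)))))
  belowᵀ-up (stem x d) (stem .x (suc d′)) (refl , d≤d′+1) t≢c =
    refl , subst (toℕ d ≤_) (sym (toℕ-inject₁ d′))
                 (ℕ.≤-pred (ℕ.≤∧≢⇒< d≤d′+1 (t≢c ∘ cong (stem x) ∘ sym ∘ toℕ-injective)))
  belowᵀ-up (stem x d) (leaf .x d′)      (refl , d≤d′) _ = refl , d≤d′
  belowᵀ-up (leaf x d) t                 t≡c       t≢c = ⊥-elim (t≢c t≡c)

  belowᵀ-down : ∀ c t → Belowᵀ c (parentᵀ t) → Belowᵀ c t
  belowᵀ-down (spine z)  (spine zero)      z≤0  = z≤0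
  belowᵀ-down (spine z)  (spine (suc z′))  z≤z′ = ≤-trans (subst (toℕ z ≤_) (toℕ-inject₁ z′) z≤z′) (n≤1+n _)
  belowᵀ-down (spine z)  (stem x zero)     z≤x  = z≤x
  belowᵀ-down (spine z)  (stem x (suc d))  z≤x  = z≤x
  belowᵀ-down (spine z)  (leaf x d)        z≤x  = z≤x
  belowᵀ-down (stem x d) (stem y (suc d′)) (y≡x , d≤d′) =
    y≡x , ≤-trans (subst (toℕ d ≤_) (toℕ-inject₁ d′) d≤d′) (n≤1+n _)
  belowᵀ-down (stem x d) (leaf y d′)       below = below
  belowᵀ-down (stem x d) (spine zero)      ()
  belowᵀ-down (stem x d) (spine (suc _))   ()
  belowᵀ-down (leaf x d) (spine zero)      ()
  belowᵀ-down (leaf x d) (spine (suc _))   ()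
  belowᵀ-down (leaf x d) (stem _ zero)     ()
  belowᵀ-down (leaf x d) (stem _ (suc _))  ()
  belowᵀ-down (leaf x d) (leaf _ _)        ()

  leafᵀ : Vertex → TreeVertex
  leafᵀ (x , d) = leaf x d

  Boundaryᵀ : TreeVertex → Vertex → Set
  Boundaryᵀ (spine _)  (x , d) = InK x × d ≡ zero
  Boundaryᵀ (stem y e) v       = v ≡ (y , e)
  Boundaryᵀ (leaf y e) v       = v ≡ (y , e)

  boundaryᵀ-clique : ∀ c u v → Boundaryᵀ c u → Boundaryᵀ c v → u ≢ v → VertexAdj u v
  boundaryᵀ-clique (spine _)  (K _ _ _ , _) (K _ _ _ , _) (_ , refl) (_ , refl) u≢v =
    inj₂ (refl , refl , u≢v ∘ cong (_, zero))
  boundaryᵀ-clique (stem _ _) _ _ refl refl u≢v = ⊥-elim (u≢v refl)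
  boundaryᵀ-clique (leaf _ _) _ _ refl refl u≢v = ⊥-elim (u≢v refl)

  boundaryᵀ-cover : ∀ c u v → VertexAdj u v → Belowᵀ c (leafᵀ u) → ¬ Belowᵀ c (leafᵀ v) →
                    Boundaryᵀ c u ⊎ Boundaryᵀ c v
  boundaryᵀ-cover (spine _) _ _ (inj₁ (refl , _)) below ¬below = ⊥-elim (¬below below)
  boundaryᵀ-cover (spine _) (x , _) (y , _) (inj₂ (refl , refl , xy)) _ _ =
    Data.Sum.map (_, refl) (_, refl) (BaseAdj-split x y xy)
  boundaryᵀ-cover (stem x d₀) (.x , d) (.x , d′) (inj₁ (refl , inj₁ d′≡d+1)) (refl , d₀≤d) ¬below =
    ⊥-elim (¬below (refl , ≤-trans d₀≤d (≤-trans (n≤1+n _) (≤-reflexive (sym d′≡d+1)))))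
  boundaryᵀ-cover (stem x d₀) (.x , d) (.x , d′) (inj₁ (refl , inj₂ d≡d′+1)) (refl , d₀≤d) ¬below =
    inj₁ (cong (x ,_) (toℕ-injective
      (ℕ.≤-antisym (≤-trans (≤-reflexive d≡d′+1) (≰⇒> (¬below ∘ (refl ,_)))) d₀≤d)))
  boundaryᵀ-cover (stem x d₀) (.x , zero) (_ , zero) (inj₂ (refl , refl , _)) (refl , d₀≤0) _ =
    inj₁ (cong (x ,_) (toℕ-injective (sym (ℕ.n≤0⇒n≡0 d₀≤0))))
  boundaryᵀ-cover (leaf _ _) _ _ _ refl _ = inj₁ refl

  parentᵀ-not-leaf : ∀ t x d → parentᵀ t ≢ leaf x d
  parentᵀ-not-leaf (spine zero)     _ _ ()
  parentᵀ-not-leaf (spine (suc _))  _ _ ()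
  parentᵀ-not-leaf (stem _ zero)    _ _ ()
  parentᵀ-not-leaf (stem _ (suc _)) _ _ ()
  parentᵀ-not-leaf (leaf _ _)       _ _ ()

  mT : ℕ
  mT = M + (n + n)

  opaque
    TreeVertex↔Fin : TreeVertex ↔ Fin mT
    TreeVertex↔Fin = ↔-sym +↔⊎ ↔-∘ (↔-refl ⊎-↔ (↔-sym +↔⊎ ↔-∘ (Vertex↔Fin ⊎-↔ Vertex↔Fin)))

  open Encoding TreeVertex↔Fin using () renaming
    (encode to encodeᵀ; decode to decodeᵀ; decode-encode to decode-encodeᵀ; encode-decode to encode-decodeᵀ;
     encode-injective to encodeᵀ-injective; decode-injective to decodeᵀ-injective)

  parent : Fin mT → Fin mT
  parent = encodeᵀ ∘ parentᵀ ∘ decodeᵀ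

  decode-parent : ∀ t → decodeᵀ (parent t) ≡ parentᵀ (decodeᵀ t)
  decode-parent t = decode-encodeᵀ _

  unrooted : ∀ {t} → parent t ≢ t → parentᵀ (decodeᵀ t) ≢ decodeᵀ t
  unrooted {t} pt≢t eq = pt≢t (trans (cong encodeᵀ eq) (encode-decodeᵀ t))

  rank-parent : ∀ t → parent t ≢ t → rankᵀ (decodeᵀ (parent t)) < rankᵀ (decodeᵀ t)
  rank-parent t pt≢t =
    subst (λ τ → rankᵀ τ < rankᵀ (decodeᵀ t)) (sym (decode-parent t)) (rankᵀ-parent _ (unrooted pt≢t))

  root-unique : ∀ t → parent t ≡ t → t ≡ encodeᵀ (spine zero)
  root-unique t pt≡t =
    trans (sym (encode-decodeᵀ t)) (cong encodeᵀ (rootᵀ-unique _ (trans (sym (decode-parent t)) (cong decodeᵀ pt≡t))))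

  open ParentTree parent (rankᵀ ∘ decodeᵀ) rank-parent (encodeᵀ (spine zero)) root-unique

  is-child : ∀ c → parent c ≢ c → ∃ λ s → c ≡ encodeᵀ (childᵀ (decodeᵀ (parent c)) s)
  is-child c pc≢c with is-childᵀ (decodeᵀ c) (unrooted pc≢c)
  ... | s , c≡child =
    s , trans (sym (encode-decodeᵀ c)) (cong encodeᵀ (trans c≡child (cong (λ τ → childᵀ τ s) (sym (decode-parent c)))))

  open WithChildren (λ t s → encodeᵀ (childᵀ (decodeᵀ t) s)) is-child

  place : Fin n → Fin mT
  place v = encodeᵀ (leafᵀ (decode v))

  place-injective : Injective _≡_ _≡_ place
  place-injective eq = decode-injective (leafᵀ-injective (encodeᵀ-injective eq))
    where
    leafᵀ-injective : ∀ {u v} → leafᵀ u ≡ leafᵀ v → u ≡ v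
    leafᵀ-injective {_ , _} {_ , _} eq = inj₂-injective (inj₂-injective eq)

  place-leaf : ∀ v → IsLeaf tree (place v)
  place-leaf v = childless⇒leaf (place v) λ c pc≡v →
    ⊥-elim (parentᵀ-not-leaf (decodeᵀ c) _ _
              (trans (sym (decode-parent c)) (trans (cong decodeᵀ pc≡v) (decode-encodeᵀ _))))

  spine-one : ∃ λ z → parentᵀ (spine z) ≡ spine zero × z ≢ zero
  spine-one = one , one-parent one (toℕ-fromℕ< 1<M) , λ eq → ℕ.1+n≢0 (trans (sym (toℕ-fromℕ< 1<M)) (cong toℕ eq))
    where
    1<M : 1 < M
    1<M = s≤s (≤-trans (s≤s z≤n) (m≤n+m _ N′))
    one : Fin M
    one = fromℕ< 1<M
    one-parent : ∀ z → toℕ z ≡ 1 → parentᵀ (spine z) ≡ spine zero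
    one-parent (suc z) z≡0 = cong spine (toℕ-injective (trans (toℕ-inject₁ z) (ℕ.suc-injective z≡0)))

  -- Every spine and stem vertex has two distinct tree neighbours, so the leaves are exactly the place v.
  place-onto : ∀ t → IsLeaf tree t → ∃ λ v → place v ≡ t
  place-onto t t-leaf = by-kind (decodeᵀ t) (encode-decodeᵀ t)
    where
    TreeEdge : TreeVertex → TreeVertex → Set
    TreeEdge τ σ = τ ≢ σ × (parentᵀ τ ≡ σ ⊎ parentᵀ σ ≡ τ)
    treeAdj : ∀ {τ σ} → TreeEdge τ σ → TreeAdj (encodeᵀ τ) (encodeᵀ σ)
    treeAdj {τ} {σ} (τ≢σ , up) =
      τ≢σ ∘ encodeᵀ-injective ,
      Data.Sum.map (cong encodeᵀ ∘ trans (cong parentᵀ (decode-encodeᵀ τ)))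
                   (cong encodeᵀ ∘ trans (cong parentᵀ (decode-encodeᵀ σ))) up
    not-leaf : ∀ {τ σ σ′} → TreeEdge τ σ → TreeEdge τ σ′ → σ ≢ σ′ → encodeᵀ τ ≡ t → ⊥
    not-leaf τσ τσ′ σ≢σ′ refl =
      σ≢σ′ (encodeᵀ-injective (leaf-unique-neighbour tree t-leaf (treeAdj τσ) (treeAdj τσ′)))
    by-kind : ∀ τ → encodeᵀ τ ≡ t → ∃ λ v → place v ≡ t
    by-kind (leaf x d) eq = encode (x , d) , trans (cong (encodeᵀ ∘ leafᵀ) (decode-encode (x , d))) eq
    by-kind (stem x zero) eq =
      ⊥-elim (not-leaf {σ = leaf x zero} {σ′ = spine (encodeᴮ x)} ((λ ()) , inj₂ refl) ((λ ()) , inj₁ refl) (λ ()) eq)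
    by-kind (stem x (suc d)) eq =
      ⊥-elim (not-leaf {σ = leaf x (suc d)} {σ′ = stem x (inject₁ d)} ((λ ()) , inj₂ refl)
               ((λ eq′ → inject₁≢suc d (sym (cong proj₂ (inj₁-injective (inj₂-injective eq′))))) , inj₁ refl)
               (λ ()) eq)
    by-kind (spine zero) eq with spine-one
    ... | one , one-parent , one≢0 =
      ⊥-elim (not-leaf {σ = stem (decodeᴮ zero) zero} {σ′ = spine one}
               ((λ ()) , inj₂ (cong spine (encode-decodeᴮ zero)))
               ((one≢0 ∘ sym ∘ inj₁-injective) , inj₂ one-parent) (λ ()) eq)
    by-kind (spine (suc z)) eq =
      ⊥-elim (not-leaf {σ = stem (decodeᴮ (suc z)) zero} {σ′ = spine (inject₁ z)}
               ((λ ()) , inj₂ (cong spine (encode-decodeᴮ (suc z))))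
               ((inject₁≢suc z ∘ sym ∘ inj₁-injective) , inj₁ refl) (λ ()) eq)

  Below : Fin mT → Pred (Fin mT) 0ℓ
  Below c t = Belowᵀ (decodeᵀ c) (decodeᵀ t)

  open SubtreeCuts G place place-injective place-leaf place-onto Below (λ c v → Boundaryᵀ (decodeᵀ c) (decode v))
    (λ c _ → belowᵀ-self (decodeᵀ c))
    (λ c pc≢c → subst (¬_ ∘ Belowᵀ (decodeᵀ c)) (sym (decode-parent c)) (belowᵀ-parent _ (unrooted pc≢c)))
    (λ c _ t below t≢c →
       subst (Belowᵀ (decodeᵀ c)) (sym (decode-parent t)) (belowᵀ-up _ _ below (t≢c ∘ decodeᵀ-injective)))
    (λ c _ t below → belowᵀ-down _ _ (subst (Belowᵀ (decodeᵀ c)) (decode-parent t) below))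
    (λ c u v bu bv u≢v → boundaryᵀ-clique (decodeᵀ c) (decode u) (decode v) bu bv (u≢v ∘ decode-injective))
    (λ c _ u v uv below ¬below → boundaryᵀ-cover (decodeᵀ c) (decode u) (decode v) uv
       (subst (Belowᵀ (decodeᵀ c)) (decode-encodeᵀ _) below)
       (¬below ∘ subst (Belowᵀ (decodeᵀ c)) (sym (decode-encodeᵀ _))))

  G-simw≡1 : SimwIs G 1
  G-simw≡1 = inj₂ (D , decomposition-cutsim≤1) , λ { zero _ → simw≥1 G hub ; (suc _) (s≤s ()) }
    where
    hub : Adj G (vertex (A zero) zero) (vertex (K true zero zero) zero)
    hub = edge (inj₂ (refl , refl , refl))

proposition6p1 : ∀ (r : ℕ) → Even r → 2 ≤ r →
    (∀ (w : ℕ) → 1 ≤ w →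
      Σ ℕ λ n → Σ (Graph n) λ G → SimwIs G 1 × SimwAtLeast (power G r) w)
    × ¬ (Σ (ℕ → ℕ) λ f →
         ∀ (n : ℕ) (G : Graph n) (k : ℕ) → SimwIs G k → SimwAtMost (power G r) (f k))
proposition6p1 _ (zero  , refl) ()
proposition6p1 _ (suc h , refl) _  = witness , no-bound
  where
  witness : ∀ w → 1 ≤ w → Σ ℕ λ n → Σ (Graph n) λ G → SimwIs G 1 × SimwAtLeast (power G (suc h + suc h)) w
  witness (suc w′) _ =
    n , G , G-simw≡1 ,
    simw≥-of-matchingsAcross (power G r) (top ∘ A) (inj₁-injective ∘ top-injective) ≤-refl (matchingsAcross (suc w′))
    where
    open Construction (suc (3 * w′)) h
  no-bound : ¬ (Σ (ℕ → ℕ) λ f → ∀ n (G : Graph n) k → SimwIs G k → SimwAtMost (power G (suc h + suc h)) (f k))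
  no-bound (f , bounded) with witness (suc (f 1)) (s≤s z≤n)
  ... | n , G , simw≡1 , simw≥ = simw≥ (f 1) ≤-refl (bounded n G 1 simw≡1)
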